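{- Let $\alpha \in [0,1]$ and let $S$ be a species tree with $n \geq 2$ leaves. Then $\mathrm{diam}(d_{PLR}, S) = 2\alpha\, H(S) + (1-\alpha)(2n-2)$. Moreover, among all species trees with $n$ leaves, $\mathrm{diam}(d_{PLR}, S)$ is maximized when $S$ is a caterpillar, in which case $\mathrm{diam}(d_{PLR}, S) = \alpha(n-1)(n-2) + (1-\alpha)(2n-2)$.
   Context: All trees are rooted; $L(T)$ is the leaf set, $L(T(v))$ the leaves descending from $v$, $\mathrm{lca}_T$ lowest common ancestor, $r(T)$ the root, $dist_T$ path length in edges. A species tree $S$ is a rooted binary tree; it is a caterpillar if every internal node has at most one child that is an internal node. A reconciled gene tree is a tuple $\mathcal{G} = (G, S, \mu, l)$ where $G$ is a rooted tree in which every internal node has at least two children, $\mu : V(G) \to V(S)$, $l : V(G) \to \{dup, spec, extant\}$, such that: (1) leaves map to leaves of $S$ and have label $extant$, internal nodes have label $dup$ or $spec$; (2) $u \preceq_G v$ implies $\mu(u) \preceq_S \mu(v)$; (3) if $l(v) = spec$ then $\mu(v)$ is internal in $S$, $v$ has exactly two children $v_1,v_2$, and with $s_1,s_2$ the children of $\mu(v)$, either $\mu(v_1) \preceq_S s_1, \mu(v_2) \preceq_S s_2$ or $\mu(v_2) \preceq_S s_1, \mu(v_1) \preceq_S s_2$. $\mathsf{G}^S$ is the set of reconciled gene trees $(G,S,\mu,l)$ such that for each $s \in L(S)$ exactly one leaf $x$ of $G$ has $\mu(x)=s$; leaves are identified by their species, so all elements of $\mathsf{G}^S$ share the same leaf set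 and leaf-species assignment. For $\mathcal{G}_1 = (G_1,S,\mu_1,l_1), \mathcal{G}_2 = (G_2,S,\mu_2,l_2)$ and $v \in V(G_1)$, $m(v) = \mathrm{lca}_{G_2}(L(G_1(v)))$; $d_{path}(\mathcal{G}_1,\mathcal{G}_2) = \sum_{v \in V(G_1)} dist_S(\mu_1(v), \mu_2(m(v)))$; $d_{lbl}(\mathcal{G}_1,\mathcal{G}_2) = |\{v \in V(G_1): l_1(v) \neq l_2(m(v))\}|$; $d_{asym} = \alpha d_{path} + (1-\alpha) d_{lbl}$; $d_{PLR}(\mathcal{G}_1,\mathcal{G}_2) = d_{asym}(\mathcal{G}_1,\mathcal{G}_2) + d_{asym}(\mathcal{G}_2,\mathcal{G}_1)$. $\mathrm{diam}(d_{PLR}, S) = \max_{\mathcal{G}_1,\mathcal{G}_2 \in \mathsf{G}^S} d_{PLR}(\mathcal{G}_1,\mathcal{G}_2)$. $H(S) = \sum_{v \in V(S)\setminus L(S)} dist_S(v, r(S))$.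
   Formalization: The parameter $\alpha$ ranges over the rational numbers in $[0,1]$. -}

module Defs where

open import Data.Nat using (ℕ; zero; suc; _+_; _*_; _∸_)
open import Data.Integer using (+_)
open import Data.Rational using (ℚ; _/_; 0ℚ; 1ℚ; _≤_) renaming (_+_ to _+ℚ_; _*_ to _*ℚ_; _-_ to _-ℚ_)
open import Data.List using (List; []; _∷_; _++_; map; filter; length)
open import Data.Nat.ListAction using (sum)
open import Data.List.Membership.DecPropositional using ()
open import Data.Product using (Σ; _×_; _,_; ∃)
open import Data.Sum using (_⊎_)
open import Data.Unit using (⊤)
open import Data.Empty using (⊥)
open import Relation.Nullary using (¬_; Dec; yes; no)
open import Relation.Nullary.Decidable using (⌊_⌋)
open import Relation.Binary.PropositionalEquality using (_≡_; _≢_; refl; cong)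
open import Data.Bool using (Bool; true; false; _∧_; _∨_)

-- Species trees: rooted binary trees (every internal node has exactly
-- two children).  The leaves of S are the species.

data BTree : Set where
  leaf : BTree
  node : BTree → BTree → BTree

leafCount : BTree → ℕ
leafCount leaf       = 1
leafCount (node l r) = leafCount l + leafCount r

-- Nodes of a species tree t, given by their position (path from root).
data Pos : BTree → Set where
  here  : ∀ {t} → Pos t
  left  : ∀ {l r} → Pos l → Pos (node l r)
  right : ∀ {l r} → Pos r → Pos (node l r)

allPos : (t : BTree) → List (Pos t)
allPos leaf       = here ∷ []
allPos (node l r) = here ∷ (map left (allPos l) ++ map right (allPos r))

data IsLeafPos : {t : BTree} → Pos t → Set where
  leaf-here  : IsLeafPos {leaf} here
  leaf-left  : ∀ {l r} {p : Pos l} → IsLeafPos p → IsLeafPos {node l r} (left p)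
  leaf-right : ∀ {l r} {p : Pos r} → IsLeafPos p → IsLeafPos {node l r} (right p)

isLeafPos : {t : BTree} → Pos t → Bool
isLeafPos {leaf}     here      = true
isLeafPos {node l r} here      = false
isLeafPos            (left p)  = isLeafPos p
isLeafPos            (right p) = isLeafPos p

isInternalPos : {t : BTree} → Pos t → Bool
isInternalPos p with isLeafPos p
... | true  = false
... | false = true

-- p ⪯ q : p is a descendant of (or equal to) q
data _⪯_ : {t : BTree} → Pos t → Pos t → Set where
  ⪯-here  : ∀ {t} {p : Pos t} → p ⪯ here
  ⪯-left  : ∀ {l r} {p q : Pos l} → p ⪯ q → _⪯_ {node l r} (left p) (left q)
  ⪯-right : ∀ {l r} {p q : Pos r} → p ⪯ q → _⪯_ {node l r} (right p) (right q)

_≟Pos_ : {t : BTree} → (p q : Pos t) → Dec (p ≡ q)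
here    ≟Pos here    = yes refl
here    ≟Pos left q  = no (λ ())
here    ≟Pos right q = no (λ ())
left p  ≟Pos here    = no (λ ())
left p  ≟Pos left q  with p ≟Pos q
... | yes refl = yes refl
... | no  ne   = no (λ { refl → ne refl })
left p  ≟Pos right q = no (λ ())
right p ≟Pos here    = no (λ ())
right p ≟Pos left q  = no (λ ())
right p ≟Pos right q with p ≟Pos q
... | yes refl = yes refl
... | no  ne   = no (λ { refl → ne refl })

depth : {t : BTree} → Pos t → ℕ
depth here      = 0
depth (left p)  = suc (depth p)
depth (right p) = suc (depth p)

dist : {t : BTree} → Pos t → Pos t → ℕ
dist here      q         = depth q
dist (left p)  here      = suc (depth p)
dist (right p) here      = suc (depth p)
dist (left p)  (left q)  = dist p q
dist (right p) (right q) = dist p q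
dist (left p)  (right q) = suc (depth p) + suc (depth q)
dist (right p) (left q)  = suc (depth p) + suc (depth q)

H : BTree → ℕ
H t = sum (map (λ v → dist v (here {t})) (filter (λ v → isInternalPos v ≟B true) (allPos t)))
  where
  open import Data.Bool.Properties renaming (_≟_ to _≟B_)

data IsCaterpillar : BTree → Set where
  cat-leaf  : IsCaterpillar leaf
  cat-nodeˡ : ∀ {r} → IsCaterpillar r → IsCaterpillar (node leaf r)
  cat-nodeʳ : ∀ {l} → IsCaterpillar l → IsCaterpillar (node l leaf)

-- A gene tree is a rooted tree in
-- which every internal node has at least two children; each node is
-- decorated with its image μ(v) ∈ V(S) and its label l(v).

data Label : Set where
  dup spec extant : Label

_≟L_ : (a b : Label) → Dec (a ≡ b)
dup    ≟L dup    = yes refl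
dup    ≟L spec   = no (λ ())
dup    ≟L extant = no (λ ())
spec   ≟L dup    = no (λ ())
spec   ≟L spec   = yes refl
spec   ≟L extant = no (λ ())
extant ≟L dup    = no (λ ())
extant ≟L spec   = no (λ ())
extant ≟L extant = yes refl

data RG (S : BTree) : Set where
  gleaf : Pos S → Label → RG S
  gnode : Pos S → Label → RG S → RG S → List (RG S) → RG S

μ : {S : BTree} → RG S → Pos S
μ (gleaf s _)         = s
μ (gnode s _ _ _ _)   = s

lab : {S : BTree} → RG S → Label
lab (gleaf _ a)       = a
lab (gnode _ a _ _ _) = a

data Sep : {t : BTree} → Pos t → Pos t → Pos t → Set where
  sep-lr : ∀ {l r} {a : Pos l} {b : Pos r} → Sep {node l r} here (left a) (right b)
  sep-rl : ∀ {l r} {a : Pos r} {b : Pos l} → Sep {node l r} here (right a) (left b)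
  sep-left  : ∀ {l r} {s a b : Pos l} → Sep s a b → Sep {node l r} (left s) (left a) (left b)
  sep-right : ∀ {l r} {s a b : Pos r} → Sep s a b → Sep {node l r} (right s) (right a) (right b)

data AllL {S : BTree} (P : RG S → Set) : List (RG S) → Set where
  []  : AllL P []
  _∷_ : ∀ {g gs} → P g → AllL P gs → AllL P (g ∷ gs)

-- validity conditions (1)-(3); condition (2) is imposed on every
-- parent/child edge, which (by transitivity of ⪯) is equivalent to
-- imposing it on every ancestor/descendant pair.
data Valid {S : BTree} : RG S → Set where
  valid-leaf : ∀ {s} → IsLeafPos s → Valid (gleaf s extant)
  valid-node : ∀ {s a c₁ c₂ cs} →
    a ≢ extant →
    μ c₁ ⪯ s → μ c₂ ⪯ s → AllL (λ c → μ c ⪯ s) cs →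
    Valid c₁ → Valid c₂ → AllL Valid cs →
    (a ≡ spec → (cs ≡ []) × Sep s (μ c₁) (μ c₂)) →
    Valid (gnode s a c₁ c₂ cs)

mutual
  leafSpecies : {S : BTree} → RG S → List (Pos S)
  leafSpecies (gleaf s _)          = s ∷ []
  leafSpecies (gnode _ _ c₁ c₂ cs) = leafSpecies c₁ ++ leafSpecies c₂ ++ leafSpeciesL cs

  leafSpeciesL : {S : BTree} → List (RG S) → List (Pos S)
  leafSpeciesL []       = []
  leafSpeciesL (c ∷ cs) = leafSpecies c ++ leafSpeciesL cs

-- all nodes of a gene tree, each represented by the subtree rooted at it
mutual
  nodes : {S : BTree} → RG S → List (RG S)
  nodes g@(gleaf _ _)          = g ∷ []
  nodes g@(gnode _ _ c₁ c₂ cs) = g ∷ (nodes c₁ ++ nodes c₂ ++ nodesL cs)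

  nodesL : {S : BTree} → List (RG S) → List (RG S)
  nodesL []       = []
  nodesL (c ∷ cs) = nodes c ++ nodesL cs

count : {S : BTree} → Pos S → List (Pos S) → ℕ
count s xs = length (filter (λ x → x ≟Pos s) xs)

InGS : (S : BTree) → RG S → Set
InGS S g = Valid g × ((s : Pos S) → IsLeafPos s → count s (leafSpecies g) ≡ 1)

_∈ᵇ_ : {S : BTree} → Pos S → List (Pos S) → Bool
s ∈ᵇ []       = false
s ∈ᵇ (x ∷ xs) = ⌊ s ≟Pos x ⌋ ∨ (s ∈ᵇ xs)

covers : {S : BTree} → RG S → List (Pos S) → Bool
covers g []       = true
covers g (x ∷ xs) = (x ∈ᵇ leafSpecies g) ∧ covers g xs

mutual
  lca : {S : BTree} → RG S → List (Pos S) → RG S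
  lca g@(gleaf _ _)          X = g
  lca g@(gnode _ _ c₁ c₂ cs) X with covers c₁ X | covers c₂ X
  ... | true  | _     = lca c₁ X
  ... | false | true  = lca c₂ X
  ... | false | false = lcaL cs X g

  lcaL : {S : BTree} → List (RG S) → List (Pos S) → RG S → RG S
  lcaL []       X dflt = dflt
  lcaL (c ∷ cs) X dflt with covers c X
  ... | true  = lca c X
  ... | false = lcaL cs X dflt

m : {S : BTree} → RG S → RG S → RG S
m G₂ v = lca G₂ (leafSpecies v)

dpath : {S : BTree} → RG S → RG S → ℕ
dpath G₁ G₂ = sum (map (λ v → dist (μ v) (μ (m G₂ v))) (nodes G₁))

mismatch : Label → Label → ℕ
mismatch a b with a ≟L b
... | yes _ = 0
... | no  _ = 1

dlbl : {S : BTree} → RG S → RG S → ℕ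
dlbl G₁ G₂ = sum (map (λ v → mismatch (lab v) (lab (m G₂ v))) (nodes G₁))

ℕtoℚ : ℕ → ℚ
ℕtoℚ n = (+ n) / 1

dasym : {S : BTree} → ℚ → RG S → RG S → ℚ
dasym α G₁ G₂ = (α *ℚ ℕtoℚ (dpath G₁ G₂)) +ℚ ((1ℚ -ℚ α) *ℚ ℕtoℚ (dlbl G₁ G₂))

dPLR : {S : BTree} → ℚ → RG S → RG S → ℚ
dPLR α G₁ G₂ = dasym α G₁ G₂ +ℚ dasym α G₂ G₁

IsDiam : (S : BTree) → ℚ → ℚ → Set
IsDiam S α D =
  ((G₁ G₂ : RG S) → InGS S G₁ → InGS S G₂ → dPLR α G₁ G₂ ≤ D) ×
  Σ (RG S) (λ G₁ → Σ (RG S) (λ G₂ → InGS S G₁ × InGS S G₂ × (dPLR α G₁ G₂ ≡ D)))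

-- For a node v of G₁ both μ₁(v) and μ₂(m(v)) are ancestors in S of every species
-- below v, so they lie on the path from the root to the lca in S of the cluster L(G₁(v)), and
-- their distance is at most the depth of that lca.  Splitting at the root of S, the clusters that
-- fall inside a clade with k internal nodes form a laminar family of at most k sets (the leaves
-- of G₁ are distinct), so summing these depths gives at most H(S); likewise G₁ has at most n − 1
-- internal nodes, which bounds d_lbl.  All four bounds are attained at once by S read as a gene
-- tree of speciations against the same tree with every internal node a duplication at the root.
-- Finally 2H(S) ≤ (n − 1)(n − 2) by induction on S, with equality for caterpillars.

module Submission where

open import Defs

open import Data.Bool using (Bool; true; false; _∧_; _∨_; if_then_else_)
open import Data.Bool.ListAction using (all)
import Data.Bool.Properties as Bool
open import Data.Empty using (⊥-elim)
import Data.Integer as ℤ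
import Data.Integer.Properties as ℤ
open import Data.List using (List; []; _∷_; _++_; map; length; filter; filterᵇ)
import Data.List.Properties as List
open import Data.List.Relation.Unary.All as All using (All; []; _∷_)
import Data.List.Relation.Unary.All.Properties as AllP
open import Data.Nat using (ℕ; zero; suc; z≤n; s≤s; _+_; _*_; _∸_; _≤_; _<_)
import Data.Nat.Coprimality as Coprime
import Data.Nat.Properties as ℕ
open import Algebra.Properties.CommutativeSemigroup ℕ.+-commutativeSemigroup using (x∙yz≈y∙xz; interchange)
open import Data.Nat.ListAction using (sum)
open import Data.Nat.ListAction.Properties using (sum-++)
open import Data.Nat.Solver using (module +-*-Solver)
open import Data.Product using (Σ; _×_; _,_; proj₁; proj₂)
open import Data.Rational using (ℚ; 0ℚ; 1ℚ; mkℚ; _/_; -_; nonNegative)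
  renaming (_≤_ to _≤ℚ_; _+_ to _+ℚ_; _*_ to _*ℚ_; _-_ to _-ℚ_)
import Data.Rational.Properties as ℚ
import Data.Rational.Solver as ℚSolver
open import Data.Sum using (_⊎_; inj₁; inj₂)
open import Function using (_∘_)
open import Relation.Binary.PropositionalEquality
open import Relation.Nullary using (Dec; yes; no)
open import Relation.Nullary.Decidable using (⌊_⌋; T?)

private variable
  S t t′ : BTree

⪯-refl : (p : Pos t) → p ⪯ p
⪯-refl here      = ⪯-here
⪯-refl (left p)  = ⪯-left (⪯-refl p)
⪯-refl (right p) = ⪯-right (⪯-refl p)

⪯-trans : {p q s : Pos t} → p ⪯ q → q ⪯ s → p ⪯ s
⪯-trans _           ⪯-here      = ⪯-here
⪯-trans (⪯-left a)  (⪯-left b)  = ⪯-left (⪯-trans a b)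
⪯-trans (⪯-right a) (⪯-right b) = ⪯-right (⪯-trans a b)

dist-self : (p : Pos t) → dist p p ≡ 0
dist-self here      = refl
dist-self (left p)  = dist-self p
dist-self (right p) = dist-self p

dist-here : (p : Pos t) → dist p here ≡ depth p
dist-here here      = refl
dist-here (left p)  = refl
dist-here (right p) = refl

isLeft isRight : {l r : BTree} → Pos (node l r) → Bool
isLeft (left _) = true
isLeft _        = false
isRight (right _) = true
isRight _         = false

-- Junk value here off the intended side.
fromLeft : {l r : BTree} → Pos (node l r) → Pos l
fromLeft (left p) = p
fromLeft _        = here

fromRight : {l r : BTree} → Pos (node l r) → Pos r
fromRight (right p) = p
fromRight _         = here

-- The depth of lca X; junk for X = [].
lcaDepth : List (Pos t) → ℕ
lcaDepth {leaf}     X = 0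
lcaDepth {node l r} X =
  if all isLeft X then suc (lcaDepth (map fromLeft X))
  else if all isRight X then suc (lcaDepth (map fromRight X))
  else 0

module _ {l r : BTree} where

  all-isLeft : {b : Pos l} {X : List (Pos (node l r))} → All (_⪯ left b) X → all isLeft X ≡ true
  all-isLeft []              = refl
  all-isLeft (⪯-left _ ∷ ps) = all-isLeft ps

  all-isRight : {b : Pos r} {X : List (Pos (node l r))} → All (_⪯ right b) X → all isRight X ≡ true
  all-isRight []               = refl
  all-isRight (⪯-right _ ∷ ps) = all-isRight ps

  fromLeft-⪯ : {b : Pos l} {X : List (Pos (node l r))} → All (_⪯ left b) X → All (_⪯ b) (map fromLeft X)
  fromLeft-⪯ []              = []
  fromLeft-⪯ (⪯-left p ∷ ps) = p ∷ fromLeft-⪯ ps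

  fromRight-⪯ : {b : Pos r} {X : List (Pos (node l r))} → All (_⪯ right b) X → All (_⪯ b) (map fromRight X)
  fromRight-⪯ []               = []
  fromRight-⪯ (⪯-right p ∷ ps) = p ∷ fromRight-⪯ ps

depth-≤-lcaDepth : (b : Pos t) {X : List (Pos t)} → X ≢ [] → All (_⪯ b) X → depth b ≤ lcaDepth X
depth-≤-lcaDepth _         X≢[] []                 = ⊥-elim (X≢[] refl)
depth-≤-lcaDepth here      _    (_ ∷ _)            = z≤n
depth-≤-lcaDepth (left b)  _    ps@(⪯-left _ ∷ _)  rewrite all-isLeft ps =
  s≤s (depth-≤-lcaDepth b (λ ()) (fromLeft-⪯ ps))
depth-≤-lcaDepth (right b) _    ps@(⪯-right _ ∷ _) rewrite all-isRight ps =
  s≤s (depth-≤-lcaDepth b (λ ()) (fromRight-⪯ ps))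

-- Two common ancestors of X lie on the path from the root to lca X.
dist-≤-lcaDepth : (a b : Pos t) {X : List (Pos t)} → X ≢ [] →
  All (_⪯ a) X → All (_⪯ b) X → dist a b ≤ lcaDepth X
dist-≤-lcaDepth here      b         X≢[] _  pb = depth-≤-lcaDepth b X≢[] pb
dist-≤-lcaDepth (left a)  here      X≢[] pa _  = depth-≤-lcaDepth (left a) X≢[] pa
dist-≤-lcaDepth (right a) here      X≢[] pa _  = depth-≤-lcaDepth (right a) X≢[] pa
dist-≤-lcaDepth _         _         X≢[] [] _  = ⊥-elim (X≢[] refl)
dist-≤-lcaDepth (left a)  (left b)  _ pa@(⪯-left _ ∷ _) pb rewrite all-isLeft pa =
  ℕ.m≤n⇒m≤1+n (dist-≤-lcaDepth a b (λ ()) (fromLeft-⪯ pa) (fromLeft-⪯ pb))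
dist-≤-lcaDepth (right a) (right b) _ pa@(⪯-right _ ∷ _) pb rewrite all-isRight pa =
  ℕ.m≤n⇒m≤1+n (dist-≤-lcaDepth a b (λ ()) (fromRight-⪯ pa) (fromRight-⪯ pb))
dist-≤-lcaDepth (left a)  (right b) _ (⪯-left _ ∷ _)  (() ∷ _)
dist-≤-lcaDepth (right a) (left b)  _ (⪯-right _ ∷ _) (() ∷ _)

≟Pos-refl : (p : Pos t) → (p ≟Pos p) ≡ yes refl
≟Pos-refl p with p ≟Pos p
... | yes refl = refl
... | no p≢p   = ⊥-elim (p≢p refl)

count-++ : (s : Pos t) (xs ys : List (Pos t)) → count s (xs ++ ys) ≡ count s xs + count s ys
count-++ s xs ys =
  trans (cong length (List.filter-++ (_≟Pos s) xs ys)) (List.length-++ (filter (_≟Pos s) xs))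

count-∷-≢ : {s x : Pos t} (xs : List (Pos t)) → x ≢ s → count s (x ∷ xs) ≡ count s xs
count-∷-≢ {s = s} {x} xs x≢s with x ≟Pos s
... | yes x≡s = ⊥-elim (x≢s x≡s)
... | no _    = refl

∈ᵇ⇒count>0 : (s : Pos t) (X : List (Pos t)) → s ∈ᵇ X ≡ true → 0 < count s X
∈ᵇ⇒count>0 s (x ∷ xs) s∈ with s ≟Pos x
... | yes refl rewrite ≟Pos-refl s = s≤s z≤n
... | no s≢x rewrite count-∷-≢ xs (s≢x ∘ sym) = ∈ᵇ⇒count>0 s xs s∈

count>0⇒∈ᵇ : (s : Pos t) (X : List (Pos t)) → 0 < count s X → s ∈ᵇ X ≡ true
count>0⇒∈ᵇ s (x ∷ xs) c with s ≟Pos x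
... | yes _    = refl
... | no s≢x rewrite count-∷-≢ xs (s≢x ∘ sym) = count>0⇒∈ᵇ s xs c

count≡0⇒∉ᵇ : (s : Pos t) (X : List (Pos t)) → count s X ≡ 0 → s ∈ᵇ X ≡ false
count≡0⇒∉ᵇ s X c with s ∈ᵇ X in s∈
... | false = refl
... | true  = ⊥-elim (ℕ.<⇒≢ (∈ᵇ⇒count>0 s X s∈) (sym c))

∈ᵇ-++ : (s : Pos t) (xs ys : List (Pos t)) → s ∈ᵇ (xs ++ ys) ≡ (s ∈ᵇ xs) ∨ (s ∈ᵇ ys)
∈ᵇ-++ s []       ys = refl
∈ᵇ-++ s (x ∷ xs) ys rewrite ∈ᵇ-++ s xs ys = sym (Bool.∨-assoc ⌊ s ≟Pos x ⌋ _ _)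

∈ᵇ-++⁺ˡ : {s : Pos t} (xs ys : List (Pos t)) → s ∈ᵇ xs ≡ true → s ∈ᵇ (xs ++ ys) ≡ true
∈ᵇ-++⁺ˡ {s = s} xs ys s∈ rewrite ∈ᵇ-++ s xs ys | s∈ = refl

∈ᵇ-++⁺ʳ : {s : Pos t} (xs ys : List (Pos t)) → s ∈ᵇ ys ≡ true → s ∈ᵇ (xs ++ ys) ≡ true
∈ᵇ-++⁺ʳ {s = s} xs ys s∈ rewrite ∈ᵇ-++ s xs ys | s∈ = Bool.∨-zeroʳ (s ∈ᵇ xs)

∈ᵇ-∷ : (s : Pos t) (xs : List (Pos t)) → s ∈ᵇ (s ∷ xs) ≡ true
∈ᵇ-∷ s xs rewrite ≟Pos-refl s = refl

infix 4 _⊆ᵇ_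

_⊆ᵇ_ : List (Pos t) → List (Pos t) → Set
X ⊆ᵇ Y = All (λ x → x ∈ᵇ Y ≡ true) X

All-∈ᵇ : {P : Pos t → Set} {Y : List (Pos t)} {x : Pos t} → All P Y → x ∈ᵇ Y ≡ true → P x
All-∈ᵇ {Y = y ∷ ys} {x} (py ∷ ps) x∈ with x ≟Pos y
... | yes refl = py
... | no _     = All-∈ᵇ ps x∈

⊆ᵇ-trans : {X Y Z : List (Pos t)} → X ⊆ᵇ Y → Y ⊆ᵇ Z → X ⊆ᵇ Z
⊆ᵇ-trans X⊆Y Y⊆Z = All.map (All-∈ᵇ Y⊆Z) X⊆Y

⊆ᵇ-refl : (X : List (Pos t)) → X ⊆ᵇ X
⊆ᵇ-refl []       = []
⊆ᵇ-refl (x ∷ xs) = ∈ᵇ-∷ x xs ∷ All.map (∈ᵇ-++⁺ʳ (x ∷ []) xs) (⊆ᵇ-refl xs)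

covers⇒⊆ᵇ : (g : RG S) (X : List (Pos S)) → covers g X ≡ true → X ⊆ᵇ leafSpecies g
covers⇒⊆ᵇ g []      _ = []
covers⇒⊆ᵇ g (x ∷ X) c = Bool.∧-conicalˡ _ _ c ∷ covers⇒⊆ᵇ g X (Bool.∧-conicalʳ _ _ c)

⊆ᵇ⇒covers : (g : RG S) {X : List (Pos S)} → X ⊆ᵇ leafSpecies g → covers g X ≡ true
⊆ᵇ⇒covers g []         = refl
⊆ᵇ⇒covers g (x∈ ∷ X⊆) rewrite x∈ = ⊆ᵇ⇒covers g X⊆

Distinct : List (Pos t) → Set
Distinct X = ∀ s → count s X ≤ 1

Distinct-++⁻ˡ : (X Y : List (Pos t)) → Distinct (X ++ Y) → Distinct X
Distinct-++⁻ˡ X Y d s = ℕ.≤-trans (ℕ.m≤m+n _ _) (subst (_≤ 1) (count-++ s X Y) (d s))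

Distinct-++⁻ʳ : (X Y : List (Pos t)) → Distinct (X ++ Y) → Distinct Y
Distinct-++⁻ʳ X Y d s = ℕ.≤-trans (ℕ.m≤n+m _ (count s X)) (subst (_≤ 1) (count-++ s X Y) (d s))

Distinct-++⇒∉ᵇʳ : {s : Pos t} (X Y : List (Pos t)) → Distinct (X ++ Y) → s ∈ᵇ X ≡ true → s ∈ᵇ Y ≡ false
Distinct-++⇒∉ᵇʳ {s = s} X Y d s∈X =
  count≡0⇒∉ᵇ s Y (sum≤1 (subst (_≤ 1) (count-++ s X Y) (d s)) (∈ᵇ⇒count>0 s X s∈X))
  where
  sum≤1 : ∀ {a b} → a + b ≤ 1 → 0 < a → b ≡ 0
  sum≤1 {suc a} {zero}  _         _ = refl
  sum≤1 {suc a} {suc b} (s≤s a+b≤0) _ with () ← subst (_≤ 0) (ℕ.+-suc a b) a+b≤0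

Distinct-++⇒∉ᵇˡ : {s : Pos t} (X Y : List (Pos t)) → Distinct (X ++ Y) → s ∈ᵇ Y ≡ true → s ∈ᵇ X ≡ false
Distinct-++⇒∉ᵇˡ X Y d = Distinct-++⇒∉ᵇʳ Y X (λ s → subst (_≤ 1) (swap s) (d s))
  where
  swap : ∀ s → count s (X ++ Y) ≡ count s (Y ++ X)
  swap s = trans (count-++ s X Y) (trans (ℕ.+-comm (count s X) _) (sym (count-++ s Y X)))

mutual
  clusters : RG S → List (List (Pos S))
  clusters (gleaf _ _)            = []
  clusters g@(gnode _ _ c₁ c₂ cs) = leafSpecies g ∷ (clusters c₁ ++ clusters c₂ ++ clustersL cs)

  clustersL : List (RG S) → List (List (Pos S))
  clustersL []       = []
  clustersL (c ∷ cs) = clusters c ++ clustersL cs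

data Binary {S : BTree} : RG S → Set where
  binary-leaf : ∀ {s a} → Binary (gleaf s a)
  binary-node : ∀ {s a c₁ c₂} → Binary c₁ → Binary c₂ → Binary (gnode s a c₁ c₂ [])

leafSpecies-inhabited : (g : RG S) → Σ (Pos S) λ x → x ∈ᵇ leafSpecies g ≡ true
leafSpecies-inhabited (gleaf s _) = s , ∈ᵇ-∷ s []
leafSpecies-inhabited (gnode _ _ c₁ c₂ cs) with leafSpecies-inhabited c₁
... | x , x∈ = x , ∈ᵇ-++⁺ˡ (leafSpecies c₁) _ x∈

leafSpecies-≢[] : (g : RG S) → leafSpecies g ≢ []
leafSpecies-≢[] g e with leafSpecies-inhabited g
... | x , x∈ rewrite e with () ← x∈

mutual
  leafSpecies-⪯-μ : {g : RG S} → Valid g → All (_⪯ μ g) (leafSpecies g)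
  leafSpecies-⪯-μ (valid-leaf _) = ⪯-refl _ ∷ []
  leafSpecies-⪯-μ (valid-node _ p₁ p₂ ps v₁ v₂ vs _) =
    AllP.++⁺ (All.map (λ q → ⪯-trans q p₁) (leafSpecies-⪯-μ v₁))
      (AllP.++⁺ (All.map (λ q → ⪯-trans q p₂) (leafSpecies-⪯-μ v₂)) (leafSpeciesL-⪯ ps vs))

  leafSpeciesL-⪯ : {s : Pos S} {cs : List (RG S)} →
    AllL (λ c → μ c ⪯ s) cs → AllL Valid cs → All (_⪯ s) (leafSpeciesL cs)
  leafSpeciesL-⪯ []       []       = []
  leafSpeciesL-⪯ (p ∷ ps) (v ∷ vs) = AllP.++⁺ (All.map (λ q → ⪯-trans q p) (leafSpecies-⪯-μ v)) (leafSpeciesL-⪯ ps vs)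

mutual
  leafSpecies-IsLeafPos : {g : RG S} → Valid g → All IsLeafPos (leafSpecies g)
  leafSpecies-IsLeafPos (valid-leaf l) = l ∷ []
  leafSpecies-IsLeafPos (valid-node _ _ _ _ v₁ v₂ vs _) =
    AllP.++⁺ (leafSpecies-IsLeafPos v₁) (AllP.++⁺ (leafSpecies-IsLeafPos v₂) (leafSpeciesL-IsLeafPos vs))

  leafSpeciesL-IsLeafPos : {cs : List (RG S)} → AllL Valid cs → All IsLeafPos (leafSpeciesL cs)
  leafSpeciesL-IsLeafPos []       = []
  leafSpeciesL-IsLeafPos (v ∷ vs) = AllP.++⁺ (leafSpecies-IsLeafPos v) (leafSpeciesL-IsLeafPos vs)

mutual
  nodes-Valid : {g : RG S} → Valid g → All Valid (nodes g)
  nodes-Valid v@(valid-leaf _) = v ∷ []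
  nodes-Valid v@(valid-node _ _ _ _ v₁ v₂ vs _) =
    v ∷ AllP.++⁺ (nodes-Valid v₁) (AllP.++⁺ (nodes-Valid v₂) (nodesL-Valid vs))

  nodesL-Valid : {cs : List (RG S)} → AllL Valid cs → All Valid (nodesL cs)
  nodesL-Valid []       = []
  nodesL-Valid (v ∷ vs) = AllP.++⁺ (nodes-Valid v) (nodesL-Valid vs)

mutual
  nodes-⊆ᵇ : (g : RG S) → All (λ v → leafSpecies v ⊆ᵇ leafSpecies g) (nodes g)
  nodes-⊆ᵇ (gleaf s _) = ⊆ᵇ-refl (s ∷ []) ∷ []
  nodes-⊆ᵇ g@(gnode _ _ c₁ c₂ cs) =
    ⊆ᵇ-refl (leafSpecies g) ∷
    AllP.++⁺ (weaken L₁ (∈ᵇ-++⁺ˡ L₁ (L₂ ++ L₃)) (nodes-⊆ᵇ c₁))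
      (AllP.++⁺ (weaken L₂ (λ x∈ → ∈ᵇ-++⁺ʳ L₁ (L₂ ++ L₃) (∈ᵇ-++⁺ˡ L₂ L₃ x∈)) (nodes-⊆ᵇ c₂))
                (weaken L₃ (λ x∈ → ∈ᵇ-++⁺ʳ L₁ (L₂ ++ L₃) (∈ᵇ-++⁺ʳ L₂ L₃ x∈)) (nodesL-⊆ᵇ cs)))
    where
    L₁ = leafSpecies c₁
    L₂ = leafSpecies c₂
    L₃ = leafSpeciesL cs
    weaken : (Y : List (Pos _)) {vs : List (RG _)} → (∀ {x} → x ∈ᵇ Y ≡ true → x ∈ᵇ leafSpecies g ≡ true) →
      All (λ v → leafSpecies v ⊆ᵇ Y) vs → All (λ v → leafSpecies v ⊆ᵇ leafSpecies g) vs
    weaken _ f = All.map (All.map f)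

  nodesL-⊆ᵇ : (cs : List (RG S)) → All (λ v → leafSpecies v ⊆ᵇ leafSpeciesL cs) (nodesL cs)
  nodesL-⊆ᵇ []       = []
  nodesL-⊆ᵇ (c ∷ cs) =
    AllP.++⁺ (All.map (All.map (∈ᵇ-++⁺ˡ (leafSpecies c) _)) (nodes-⊆ᵇ c))
             (All.map (All.map (∈ᵇ-++⁺ʳ (leafSpecies c) _)) (nodesL-⊆ᵇ cs))

¬covers : (g : RG S) (X : List (Pos S)) {x : Pos S} →
  x ∈ᵇ X ≡ true → x ∈ᵇ leafSpecies g ≡ false → covers g X ≡ false
¬covers g X x∈X x∉g with covers g X in c
... | false = refl
... | true with () ← trans (sym (All-∈ᵇ (covers⇒⊆ᵇ g X c) x∈X)) x∉g

module _ {s : Pos S} {a : Label} {c₁ c₂ : RG S} where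

  lca-descend₁ : {cs : List (RG S)} (X : List (Pos S)) → covers c₁ X ≡ true →
    lca (gnode s a c₁ c₂ cs) X ≡ lca c₁ X
  lca-descend₁ X c rewrite c = refl

  lca-descend₂ : {cs : List (RG S)} (X : List (Pos S)) → covers c₁ X ≡ false → covers c₂ X ≡ true →
    lca (gnode s a c₁ c₂ cs) X ≡ lca c₂ X
  lca-descend₂ X c c′ rewrite c | c′ = refl

  lca-stop : (X : List (Pos S)) → covers c₁ X ≡ false → covers c₂ X ≡ false →
    lca (gnode s a c₁ c₂ []) X ≡ gnode s a c₁ c₂ []
  lca-stop X c c′ rewrite c | c′ = refl

mutual
  lca-covers : (g : RG S) (X : List (Pos S)) → covers g X ≡ true → covers (lca g X) X ≡ true
  lca-covers (gleaf _ _) X c = c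
  lca-covers (gnode _ _ c₁ c₂ cs) X c with covers c₁ X in c₁X | covers c₂ X in c₂X
  ... | true  | _     = lca-covers c₁ X c₁X
  ... | false | true  = lca-covers c₂ X c₂X
  ... | false | false = lcaL-covers cs X _ c

  lcaL-covers : (cs : List (RG S)) (X : List (Pos S)) (d : RG S) → covers d X ≡ true → covers (lcaL cs X d) X ≡ true
  lcaL-covers []       X d c = c
  lcaL-covers (c ∷ cs) X d cd with covers c X in cX
  ... | true  = lca-covers c X cX
  ... | false = lcaL-covers cs X d cd

mutual
  lca-Valid : {g : RG S} (X : List (Pos S)) → Valid g → Valid (lca g X)
  lca-Valid {g = gleaf _ _} X v = v
  lca-Valid {g = gnode _ _ c₁ c₂ cs} X v@(valid-node _ _ _ _ v₁ v₂ vs _) with covers c₁ X | covers c₂ X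
  ... | true  | _     = lca-Valid X v₁
  ... | false | true  = lca-Valid X v₂
  ... | false | false = lcaL-Valid X vs v

  lcaL-Valid : {cs : List (RG S)} {d : RG S} (X : List (Pos S)) → AllL Valid cs → Valid d → Valid (lcaL cs X d)
  lcaL-Valid {cs = []}     X []        v = v
  lcaL-Valid {cs = c ∷ cs} X (vc ∷ vs) v with covers c X
  ... | true  = lca-Valid X vc
  ... | false = lcaL-Valid X vs v

covers-single : (g : RG S) (s : Pos S) → covers g (s ∷ []) ≡ s ∈ᵇ leafSpecies g
covers-single g s = Bool.∧-identityʳ (s ∈ᵇ leafSpecies g)

mutual
  lca-leaf : {g : RG S} (s : Pos S) → Valid g → s ∈ᵇ leafSpecies g ≡ true → lca g (s ∷ []) ≡ gleaf s extant
  lca-leaf {g = gleaf t _} s (valid-leaf _) s∈ with s ≟Pos t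
  ... | yes refl = refl
  lca-leaf {g = gnode _ _ c₁ c₂ cs} s (valid-node _ _ _ _ v₁ v₂ vs _) s∈
    with covers c₁ (s ∷ []) in s∈₁ | covers c₂ (s ∷ []) in s∈₂
  ... | true  | _    = lca-leaf s v₁ (trans (sym (covers-single c₁ s)) s∈₁)
  ... | false | true = lca-leaf s v₂ (trans (sym (covers-single c₂ s)) s∈₂)
  ... | false | false = lcaL-leaf s vs s∈cs
    where
    s∈cs : s ∈ᵇ leafSpeciesL cs ≡ true
    s∈cs rewrite ∈ᵇ-++ s (leafSpecies c₁) (leafSpecies c₂ ++ leafSpeciesL cs)
               | ∈ᵇ-++ s (leafSpecies c₂) (leafSpeciesL cs)
               | trans (sym (covers-single c₁ s)) s∈₁ | trans (sym (covers-single c₂ s)) s∈₂ = s∈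

  lcaL-leaf : {cs : List (RG S)} {d : RG S} (s : Pos S) → AllL Valid cs → s ∈ᵇ leafSpeciesL cs ≡ true →
    lcaL cs (s ∷ []) d ≡ gleaf s extant
  lcaL-leaf {cs = c ∷ cs} s (vc ∷ vs) s∈ with covers c (s ∷ []) in s∈c
  ... | true  = lca-leaf s vc (trans (sym (covers-single c s)) s∈c)
  ... | false = lcaL-leaf s vs s∈cs
    where
    s∈cs : s ∈ᵇ leafSpeciesL cs ≡ true
    s∈cs rewrite ∈ᵇ-++ s (leafSpecies c) (leafSpeciesL cs) | trans (sym (covers-single c s)) s∈c = s∈

-- Bounding d_path and d_lbl cluster by cluster

sum-map-++ : {A : Set} (f : A → ℕ) (xs ys : List A) → sum (map f (xs ++ ys)) ≡ sum (map f xs) + sum (map f ys)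
sum-map-++ f xs ys = trans (cong sum (List.map-++ f xs ys)) (sum-++ (map f xs) (map f ys))

sum-map-mono-≤ : {A : Set} {f g : A → ℕ} {xs : List A} → All (λ x → f x ≤ g x) xs → sum (map f xs) ≤ sum (map g xs)
sum-map-mono-≤ []       = z≤n
sum-map-mono-≤ (p ∷ ps) = ℕ.+-mono-≤ p (sum-map-mono-≤ ps)

sum-map-1 : {A : Set} (xs : List A) → sum (map (λ _ → 1) xs) ≡ length xs
sum-map-1 []       = refl
sum-map-1 (_ ∷ xs) = cong suc (sum-map-1 xs)

atInternal : (List (Pos S) → ℕ) → RG S → ℕ
atInternal c (gleaf _ _)            = 0
atInternal c g@(gnode _ _ _ _ _) = c (leafSpecies g)

mutual
  sum-clusters : (c : List (Pos S) → ℕ) (g : RG S) → sum (map c (clusters g)) ≡ sum (map (atInternal c) (nodes g))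
  sum-clusters c (gleaf _ _) = refl
  sum-clusters c g@(gnode _ _ c₁ c₂ cs)
    rewrite sum-map-++ c (clusters c₁) (clusters c₂ ++ clustersL cs) | sum-map-++ c (clusters c₂) (clustersL cs)
          | sum-map-++ (atInternal c) (nodes c₁) (nodes c₂ ++ nodesL cs) | sum-map-++ (atInternal c) (nodes c₂) (nodesL cs)
          | sum-clusters c c₁ | sum-clusters c c₂ | sum-clustersL c cs = refl

  sum-clustersL : (c : List (Pos S) → ℕ) (cs : List (RG S)) → sum (map c (clustersL cs)) ≡ sum (map (atInternal c) (nodesL cs))
  sum-clustersL c []       = refl
  sum-clustersL c (g ∷ cs)
    rewrite sum-map-++ c (clusters g) (clustersL cs) | sum-map-++ (atInternal c) (nodes g) (nodesL cs)
          | sum-clusters c g | sum-clustersL c cs = refl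

sum-nodes-≤-clusters : (w : RG S → ℕ) (c : List (Pos S) → ℕ) (g : RG S) →
  All (λ v → w v ≤ atInternal c v) (nodes g) → sum (map w (nodes g)) ≤ sum (map c (clusters g))
sum-nodes-≤-clusters w c g bound = subst (sum (map w (nodes g)) ≤_) (sym (sum-clusters c g)) (sum-map-mono-≤ bound)

mismatch-≤-1 : (a b : Label) → mismatch a b ≤ 1
mismatch-≤-1 a b with a ≟L b
... | yes _ = z≤n
... | no _  = s≤s z≤n

module _ {G₂ : RG S} (V₂ : Valid G₂) where

  dist-μ-m-≤ : {v : RG S} → Valid v → leafSpecies v ⊆ᵇ leafSpecies G₂ → dist (μ v) (μ (m G₂ v)) ≤ atInternal lcaDepth v
  dist-μ-m-≤ (valid-leaf {s} _) (s∈ ∷ []) rewrite lca-leaf s V₂ s∈ = ℕ.≤-reflexive (dist-self s)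
  dist-μ-m-≤ {v = v@(gnode _ _ _ _ _)} V X⊆ =
    dist-≤-lcaDepth (μ v) (μ r) (leafSpecies-≢[] v) (leafSpecies-⪯-μ V)
      (All.map (All-∈ᵇ (leafSpecies-⪯-μ (lca-Valid X V₂))) (covers⇒⊆ᵇ r X (lca-covers G₂ X (⊆ᵇ⇒covers G₂ X⊆))))
    where
    X = leafSpecies v
    r = lca G₂ X

  mismatch-m-≤ : {v : RG S} → Valid v → leafSpecies v ⊆ᵇ leafSpecies G₂ →
    mismatch (lab v) (lab (m G₂ v)) ≤ atInternal (λ _ → 1) v
  mismatch-m-≤ (valid-leaf {s} _) (s∈ ∷ []) rewrite lca-leaf s V₂ s∈ = z≤n
  mismatch-m-≤ {v = gnode _ a _ _ _} _ _ = mismatch-≤-1 a _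

  module _ {G₁ : RG S} (V₁ : Valid G₁) (G₁⊆G₂ : leafSpecies G₁ ⊆ᵇ leafSpecies G₂) where

    nodes-All : {B : RG S → Set} → (∀ {v} → Valid v → leafSpecies v ⊆ᵇ leafSpecies G₂ → B v) → All B (nodes G₁)
    nodes-All f =
      All.zipWith (λ (V , v⊆) → f V (⊆ᵇ-trans {Z = leafSpecies G₂} v⊆ G₁⊆G₂)) (nodes-Valid V₁ , nodes-⊆ᵇ G₁)

    dpath-≤-lcaDepths : dpath G₁ G₂ ≤ sum (map lcaDepth (clusters G₁))
    dpath-≤-lcaDepths = sum-nodes-≤-clusters _ lcaDepth G₁ (nodes-All dist-μ-m-≤)

    dlbl-≤-#clusters : dlbl G₁ G₂ ≤ length (clusters G₁)
    dlbl-≤-#clusters = subst (dlbl G₁ G₂ ≤_) (sum-map-1 (clusters G₁))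
      (sum-nodes-≤-clusters _ (λ _ → 1) G₁ (nodes-All mismatch-m-≤))

mutual
  clusters-length : (g : RG S) → suc (length (clusters g)) ≤ length (leafSpecies g)
  clusters-length (gleaf _ _) = s≤s z≤n
  clusters-length (gnode _ _ c₁ c₂ cs)
    rewrite List.length-++ (clusters c₁) {clusters c₂ ++ clustersL cs} | List.length-++ (clusters c₂) {clustersL cs}
          | List.length-++ (leafSpecies c₁) {leafSpecies c₂ ++ leafSpeciesL cs}
          | List.length-++ (leafSpecies c₂) {leafSpeciesL cs} = begin
      suc (suc (a + (b + c)))  ≡⟨ cong suc (ℕ.+-suc a (b + c)) ⟨
      suc a + (suc b + c)      ≤⟨ ℕ.+-mono-≤ (clusters-length c₁) (ℕ.+-mono-≤ (clusters-length c₂) c≤) ⟩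
      length (leafSpecies c₁) + (length (leafSpecies c₂) + length (leafSpeciesL cs)) ∎
    where
    open ℕ.≤-Reasoning
    a = length (clusters c₁)
    b = length (clusters c₂)
    c = length (clustersL cs)
    c≤ : c ≤ length (leafSpeciesL cs)
    c≤ = ℕ.≤-trans (ℕ.m≤m+n c (length cs)) (clustersL-length cs)

  clustersL-length : (cs : List (RG S)) → length (clustersL cs) + length cs ≤ length (leafSpeciesL cs)
  clustersL-length []       = z≤n
  clustersL-length (c ∷ cs)
    rewrite List.length-++ (clusters c) {clustersL cs} | List.length-++ (leafSpecies c) {leafSpeciesL cs} = begin
      length (clusters c) + length (clustersL cs) + suc (length cs)  ≡⟨ ℕ.+-suc _ (length cs) ⟩
      suc (length (clusters c) + length (clustersL cs) + length cs)  ≡⟨ cong suc (ℕ.+-assoc (length (clusters c)) _ _) ⟩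
      suc (length (clusters c)) + (length (clustersL cs) + length cs)
        ≤⟨ ℕ.+-mono-≤ (clusters-length c) (clustersL-length cs) ⟩
      length (leafSpecies c) + length (leafSpeciesL cs)              ∎
    where open ℕ.≤-Reasoning

clustersL-length-≤ : (cs : List (RG S)) {k : ℕ} → length (leafSpeciesL cs) ≤ suc k → length (clustersL cs) ≤ k
clustersL-length-≤ []           _ = z≤n
clustersL-length-≤ cs@(_ ∷ cs′) {k} h = ℕ.≤-pred (begin
  suc (length (clustersL cs))                ≤⟨ s≤s (ℕ.m≤m+n _ (length cs′)) ⟩
  suc (length (clustersL cs) + length cs′)   ≡⟨ ℕ.+-suc _ (length cs′) ⟨
  length (clustersL cs) + length cs          ≤⟨ clustersL-length cs ⟩
  length (leafSpeciesL cs)                   ≤⟨ h ⟩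
  suc k                                      ∎)
  where open ℕ.≤-Reasoning

internals : BTree → ℕ
internals leaf       = 0
internals (node l r) = suc (internals l + internals r)

leafCount≡1+internals : (t : BTree) → leafCount t ≡ suc (internals t)
leafCount≡1+internals leaf       = refl
leafCount≡1+internals (node l r) rewrite leafCount≡1+internals l | leafCount≡1+internals r =
  cong suc (ℕ.+-suc (internals l) (internals r))

module _ {l r : BTree} where

  leftPart : List (Pos (node l r)) → List (Pos l)
  leftPart X = map fromLeft (filterᵇ isLeft X)

  rightPart : List (Pos (node l r)) → List (Pos r)
  rightPart X = map fromRight (filterᵇ isRight X)

  count-leftPart : (s : Pos l) (X : List (Pos (node l r))) → count s (leftPart X) ≡ count (left s) X
  count-leftPart s []            = refl
  count-leftPart s (here ∷ X)    rewrite count-∷-≢ {s = left s} {x = here} X (λ ())    = count-leftPart s X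
  count-leftPart s (right p ∷ X) rewrite count-∷-≢ {s = left s} {x = right p} X (λ ()) = count-leftPart s X
  count-leftPart s (left p ∷ X)  with p ≟Pos s
  ... | yes refl = cong suc (count-leftPart p X)
  ... | no _     = count-leftPart s X

  count-rightPart : (s : Pos r) (X : List (Pos (node l r))) → count s (rightPart X) ≡ count (right s) X
  count-rightPart s []            = refl
  count-rightPart s (here ∷ X)    rewrite count-∷-≢ {s = right s} {x = here} X (λ ())   = count-rightPart s X
  count-rightPart s (left p ∷ X)  rewrite count-∷-≢ {s = right s} {x = left p} X (λ ()) = count-rightPart s X
  count-rightPart s (right p ∷ X) with p ≟Pos s
  ... | yes refl = cong suc (count-rightPart p X)
  ... | no _     = count-rightPart s X

  Distinct-leftPart : (X : List (Pos (node l r))) → Distinct X → Distinct (leftPart X)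
  Distinct-leftPart X d s = subst (_≤ 1) (sym (count-leftPart s X)) (d (left s))

  Distinct-rightPart : (X : List (Pos (node l r))) → Distinct X → Distinct (rightPart X)
  Distinct-rightPart X d s = subst (_≤ 1) (sym (count-rightPart s X)) (d (right s))

  leftPart-IsLeafPos : {X : List (Pos (node l r))} → All IsLeafPos X → All IsLeafPos (leftPart X)
  leftPart-IsLeafPos []                  = []
  leftPart-IsLeafPos (leaf-left p  ∷ ps) = p ∷ leftPart-IsLeafPos ps
  leftPart-IsLeafPos (leaf-right _ ∷ ps) = leftPart-IsLeafPos ps

  rightPart-IsLeafPos : {X : List (Pos (node l r))} → All IsLeafPos X → All IsLeafPos (rightPart X)
  rightPart-IsLeafPos []                  = []
  rightPart-IsLeafPos (leaf-left _  ∷ ps) = rightPart-IsLeafPos ps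
  rightPart-IsLeafPos (leaf-right p ∷ ps) = p ∷ rightPart-IsLeafPos ps

  length-leftPart+rightPart : {X : List (Pos (node l r))} → All IsLeafPos X →
    length X ≡ length (leftPart X) + length (rightPart X)
  length-leftPart+rightPart []                  = refl
  length-leftPart+rightPart (leaf-left _  ∷ ps) = cong suc (length-leftPart+rightPart ps)
  length-leftPart+rightPart (leaf-right _ ∷ ps) =
    trans (cong suc (length-leftPart+rightPart ps)) (sym (ℕ.+-suc _ _))

Distinct-leaves-≤ : (t : BTree) (X : List (Pos t)) → Distinct X → All IsLeafPos X → length X ≤ leafCount t
Distinct-leaves-≤ leaf       X d _ = subst (_≤ 1) (count-here X) (d here)
  where
  count-here : (X : List (Pos leaf)) → count here X ≡ length X
  count-here []         = refl
  count-here (here ∷ X) = cong suc (count-here X)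
Distinct-leaves-≤ (node l r) X d a rewrite length-leftPart+rightPart a =
  ℕ.+-mono-≤ (Distinct-leaves-≤ l _ (Distinct-leftPart X d) (leftPart-IsLeafPos a))
             (Distinct-leaves-≤ r _ (Distinct-rightPart X d) (rightPart-IsLeafPos a))

all-++ : {A : Set} (p : A → Bool) (xs ys : List A) → all p (xs ++ ys) ≡ all p xs ∧ all p ys
all-++ p []       ys = refl
all-++ p (x ∷ xs) ys rewrite all-++ p xs ys = sym (Bool.∧-assoc (p x) _ _)

all⇒All : {A : Set} (p : A → Bool) (xs : List A) → all p xs ≡ true → All (λ x → p x ≡ true) xs
all⇒All p []       _ = []
all⇒All p (x ∷ xs) e = Bool.∧-conicalˡ _ _ e ∷ all⇒All p xs (Bool.∧-conicalʳ _ _ e)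

filterᵇ-all : {A : Set} (p : A → Bool) {xs : List A} → All (λ x → p x ≡ true) xs → filterᵇ p xs ≡ xs
filterᵇ-all p []                 = refl
filterᵇ-all p {x ∷ _} (px ∷ pxs) rewrite px = cong (x ∷_) (filterᵇ-all p pxs)

filterᵇ-++ : {A : Set} (p : A → Bool) (xs ys : List A) → filterᵇ p (xs ++ ys) ≡ filterᵇ p xs ++ filterᵇ p ys
filterᵇ-++ p = List.filter-++ (T? ∘ p)

mutual
  mapRG : (Pos t → Pos t′) → RG t → RG t′
  mapRG f (gleaf s a)          = gleaf (f s) a
  mapRG f (gnode s a c₁ c₂ cs) = gnode (f s) a (mapRG f c₁) (mapRG f c₂) (mapRGL f cs)

  mapRGL : (Pos t → Pos t′) → List (RG t) → List (RG t′)
  mapRGL f []       = []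
  mapRGL f (c ∷ cs) = mapRG f c ∷ mapRGL f cs

mutual
  leafSpecies-mapRG : (f : Pos t → Pos t′) (g : RG t) → leafSpecies (mapRG f g) ≡ map f (leafSpecies g)
  leafSpecies-mapRG f (gleaf s a) = refl
  leafSpecies-mapRG f (gnode s a c₁ c₂ cs)
    rewrite leafSpecies-mapRG f c₁ | leafSpecies-mapRG f c₂ | leafSpeciesL-mapRG f cs
          | List.map-++ f (leafSpecies c₁) (leafSpecies c₂ ++ leafSpeciesL cs)
          | List.map-++ f (leafSpecies c₂) (leafSpeciesL cs) = refl

  leafSpeciesL-mapRG : (f : Pos t → Pos t′) (cs : List (RG t)) → leafSpeciesL (mapRGL f cs) ≡ map f (leafSpeciesL cs)
  leafSpeciesL-mapRG f []       = refl
  leafSpeciesL-mapRG f (c ∷ cs)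
    rewrite leafSpecies-mapRG f c | leafSpeciesL-mapRG f cs | List.map-++ f (leafSpecies c) (leafSpeciesL cs) = refl

mutual
  clusters-mapRG : (f : Pos t → Pos t′) (g : RG t) → clusters (mapRG f g) ≡ map (map f) (clusters g)
  clusters-mapRG f (gleaf s a) = refl
  clusters-mapRG f g@(gnode s a c₁ c₂ cs)
    rewrite leafSpecies-mapRG f g | clusters-mapRG f c₁ | clusters-mapRG f c₂ | clustersL-mapRG f cs
          | List.map-++ (map f) (clusters c₁) (clusters c₂ ++ clustersL cs)
          | List.map-++ (map f) (clusters c₂) (clustersL cs) = refl

  clustersL-mapRG : (f : Pos t → Pos t′) (cs : List (RG t)) → clustersL (mapRGL f cs) ≡ map (map f) (clustersL cs)
  clustersL-mapRG f []       = refl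
  clustersL-mapRG f (c ∷ cs)
    rewrite clusters-mapRG f c | clustersL-mapRG f cs | List.map-++ (map f) (clusters c) (clustersL cs) = refl

all-++⁻ : {A : Set} (p : A → Bool) (xs ys : List A) → all p (xs ++ ys) ≡ true → all p xs ≡ true × all p ys ≡ true
all-++⁻ p xs ys e = let e′ = trans (sym (all-++ p xs ys)) e in Bool.∧-conicalˡ _ _ e′ , Bool.∧-conicalʳ _ _ e′

mutual
  clusters-all : (p : Pos t → Bool) (g : RG t) → all p (leafSpecies g) ≡ true → All (λ C → all p C ≡ true) (clusters g)
  clusters-all p (gleaf s a) _ = []
  clusters-all p (gnode s a c₁ c₂ cs) e with all-++⁻ p (leafSpecies c₁) _ e
  ... | e₁ , e₂₃ with all-++⁻ p (leafSpecies c₂) _ e₂₃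
  ... | e₂ , e₃ = e ∷ AllP.++⁺ (clusters-all p c₁ e₁) (AllP.++⁺ (clusters-all p c₂ e₂) (clustersL-all p cs e₃))

  clustersL-all : (p : Pos t → Bool) (cs : List (RG t)) → all p (leafSpeciesL cs) ≡ true →
    All (λ C → all p C ≡ true) (clustersL cs)
  clustersL-all p []       _ = []
  clustersL-all p (c ∷ cs) e with all-++⁻ p (leafSpecies c) _ e
  ... | e₁ , e₂ = AllP.++⁺ (clusters-all p c e₁) (clustersL-all p cs e₂)

leafSpeciesL-++ : (xs ys : List (RG t)) → leafSpeciesL (xs ++ ys) ≡ leafSpeciesL xs ++ leafSpeciesL ys
leafSpeciesL-++ []       ys = refl
leafSpeciesL-++ (x ∷ xs) ys rewrite leafSpeciesL-++ xs ys = sym (List.++-assoc (leafSpecies x) _ _)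

clustersL-++ : (xs ys : List (RG t)) → clustersL (xs ++ ys) ≡ clustersL xs ++ clustersL ys
clustersL-++ []       ys = refl
clustersL-++ (x ∷ xs) ys rewrite clustersL-++ xs ys = sym (List.++-assoc (clusters x) _ _)

-- The maximal subtrees all of whose leaves satisfy p, with species relocated by f.
module Restriction (p : Pos t → Bool) (f : Pos t → Pos t′) where

  mutual
    restrict : RG t → List (RG t′)
    restrict g with all p (leafSpecies g)
    ... | true = mapRG f g ∷ []
    restrict (gleaf _ _)          | false = []
    restrict (gnode _ _ c₁ c₂ cs) | false = restrict c₁ ++ restrict c₂ ++ restrictL cs

    restrictL : List (RG t) → List (RG t′)
    restrictL []       = []
    restrictL (c ∷ cs) = restrict c ++ restrictL cs

  mutual
    leafSpecies-restrict : (g : RG t) → leafSpeciesL (restrict g) ≡ map f (filterᵇ p (leafSpecies g))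
    leafSpecies-restrict g with all p (leafSpecies g) in e
    ... | true = trans (List.++-identityʳ _)
                   (trans (leafSpecies-mapRG f g) (cong (map f) (sym (filterᵇ-all p (all⇒All p _ e)))))
    leafSpecies-restrict (gleaf s a) | false with p s
    ... | false = refl
    leafSpecies-restrict (gnode _ _ c₁ c₂ cs) | false
      rewrite leafSpeciesL-++ (restrict c₁) (restrict c₂ ++ restrictL cs) | leafSpeciesL-++ (restrict c₂) (restrictL cs)
            | leafSpecies-restrict c₁ | leafSpecies-restrict c₂ | leafSpecies-restrictL cs
            | filterᵇ-++ p (leafSpecies c₁) (leafSpecies c₂ ++ leafSpeciesL cs)
            | filterᵇ-++ p (leafSpecies c₂) (leafSpeciesL cs)
            | List.map-++ f (filterᵇ p (leafSpecies c₁)) (filterᵇ p (leafSpecies c₂) ++ filterᵇ p (leafSpeciesL cs))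
            | List.map-++ f (filterᵇ p (leafSpecies c₂)) (filterᵇ p (leafSpeciesL cs)) = refl

    leafSpecies-restrictL : (cs : List (RG t)) → leafSpeciesL (restrictL cs) ≡ map f (filterᵇ p (leafSpeciesL cs))
    leafSpecies-restrictL []       = refl
    leafSpecies-restrictL (c ∷ cs)
      rewrite leafSpeciesL-++ (restrict c) (restrictL cs) | leafSpecies-restrict c | leafSpecies-restrictL cs
            | filterᵇ-++ p (leafSpecies c) (leafSpeciesL cs)
            | List.map-++ f (filterᵇ p (leafSpecies c)) (filterᵇ p (leafSpeciesL cs)) = refl

  mutual
    clusters-restrict : (g : RG t) → clustersL (restrict g) ≡ map (map f) (filterᵇ (all p) (clusters g))
    clusters-restrict g with all p (leafSpecies g) in e
    ... | true = trans (List.++-identityʳ _)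
                   (trans (clusters-mapRG f g) (cong (map (map f)) (sym (filterᵇ-all (all p) (clusters-all p g e)))))
    clusters-restrict (gleaf s a) | false = refl
    clusters-restrict (gnode s a c₁ c₂ cs) | false
      rewrite e
            | clustersL-++ (restrict c₁) (restrict c₂ ++ restrictL cs) | clustersL-++ (restrict c₂) (restrictL cs)
            | clusters-restrict c₁ | clusters-restrict c₂ | clusters-restrictL cs
            | filterᵇ-++ (all p) (clusters c₁) (clusters c₂ ++ clustersL cs)
            | filterᵇ-++ (all p) (clusters c₂) (clustersL cs)
            | List.map-++ (map f) (filterᵇ (all p) (clusters c₁))
                (filterᵇ (all p) (clusters c₂) ++ filterᵇ (all p) (clustersL cs))
            | List.map-++ (map f) (filterᵇ (all p) (clusters c₂)) (filterᵇ (all p) (clustersL cs)) = refl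

    clusters-restrictL : (cs : List (RG t)) → clustersL (restrictL cs) ≡ map (map f) (filterᵇ (all p) (clustersL cs))
    clusters-restrictL []       = refl
    clusters-restrictL (c ∷ cs)
      rewrite clustersL-++ (restrict c) (restrictL cs) | clusters-restrict c | clusters-restrictL cs
            | filterᵇ-++ (all p) (clusters c) (clustersL cs)
            | List.map-++ (map f) (filterᵇ (all p) (clusters c)) (filterᵇ (all p) (clustersL cs)) = refl

-- The H(S) bound

sum-map-if-≤ : {A : Set} (p q : A → Bool) (a b : A → ℕ) (xs : List A) →
  sum (map (λ x → if p x then a x else if q x then b x else 0) xs) ≤
  sum (map a (filterᵇ p xs)) + sum (map b (filterᵇ q xs))
sum-map-if-≤ p q a b []       = z≤n
sum-map-if-≤ p q a b (x ∷ xs) with ih ← sum-map-if-≤ p q a b xs | p x | q x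
... | true  | true  = begin
  a x + _                   ≤⟨ ℕ.+-monoʳ-≤ (a x) ih ⟩
  a x + (A + B)             ≡⟨ ℕ.+-assoc (a x) A B ⟨
  a x + A + B               ≤⟨ ℕ.+-monoʳ-≤ (a x + A) (ℕ.m≤n+m B (b x)) ⟩
  a x + A + (b x + B)       ∎
  where
  open ℕ.≤-Reasoning
  A = sum (map a (filterᵇ p xs))
  B = sum (map b (filterᵇ q xs))
... | true  | false = ℕ.≤-trans (ℕ.+-monoʳ-≤ (a x) ih) (ℕ.≤-reflexive (sym (ℕ.+-assoc (a x) _ _)))
... | false | true  = ℕ.≤-trans (ℕ.+-monoʳ-≤ (b x) ih)
  (ℕ.≤-reflexive (x∙yz≈y∙xz (b x) (sum (map a (filterᵇ p xs))) (sum (map b (filterᵇ q xs)))))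
... | false | false = ih

sum-map-suc : {A : Set} (g : A → ℕ) (xs : List A) → sum (map (suc ∘ g) xs) ≡ length xs + sum (map g xs)
sum-map-suc g []       = refl
sum-map-suc g (x ∷ xs) = cong suc (trans (cong (g x +_) (sum-map-suc g xs)) (x∙yz≈y∙xz (g x) (length xs) _))

rootDist : Pos t → ℕ
rootDist v = dist v here

IsInternal? : (v : Pos t) → Dec (isInternalPos v ≡ true)
IsInternal? v = isInternalPos v Bool.≟ true

filter-internal-map : (emb : Pos t → Pos t′) → (∀ p → isInternalPos (emb p) ≡ isInternalPos p) →
  (xs : List (Pos t)) → filter IsInternal? (map emb xs) ≡ map emb (filter IsInternal? xs)
filter-internal-map emb internal-emb []       = refl
filter-internal-map emb internal-emb (x ∷ xs) rewrite internal-emb x with isInternalPos x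
... | true  = cong (emb x ∷_) (filter-internal-map emb internal-emb xs)
... | false = filter-internal-map emb internal-emb xs

sum-rootDist-map : (emb : Pos t → Pos t′) → (∀ p → rootDist (emb p) ≡ suc (rootDist p)) →
  (xs : List (Pos t)) → sum (map rootDist (map emb xs)) ≡ length xs + sum (map rootDist xs)
sum-rootDist-map emb rootDist-emb xs = begin
  sum (map rootDist (map emb xs))    ≡⟨ cong sum (List.map-∘ xs) ⟨
  sum (map (rootDist ∘ emb) xs)      ≡⟨ cong sum (List.map-cong rootDist-emb xs) ⟩
  sum (map (suc ∘ rootDist) xs)      ≡⟨ sum-map-suc rootDist xs ⟩
  length xs + sum (map rootDist xs)  ∎
  where open ≡-Reasoning

module _ {l r : BTree} where

  isInternalPos-left : (p : Pos l) → isInternalPos (left {r = r} p) ≡ isInternalPos p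
  isInternalPos-left p with isLeafPos p
  ... | true  = refl
  ... | false = refl

  isInternalPos-right : (p : Pos r) → isInternalPos (right {l = l} p) ≡ isInternalPos p
  isInternalPos-right p with isLeafPos p
  ... | true  = refl
  ... | false = refl

  rootDist-left : (p : Pos l) → rootDist (left {r = r} p) ≡ suc (rootDist p)
  rootDist-left p = cong suc (sym (dist-here p))

  rootDist-right : (p : Pos r) → rootDist (right {l = l} p) ≡ suc (rootDist p)
  rootDist-right p = cong suc (sym (dist-here p))

  filter-internal-children :
    filter IsInternal? (map left (allPos l) ++ map right (allPos r)) ≡
    map left (filter IsInternal? (allPos l)) ++ map right (filter IsInternal? (allPos r))
  filter-internal-children = trans (List.filter-++ IsInternal? (map left (allPos l)) _)
    (cong₂ _++_ (filter-internal-map left isInternalPos-left (allPos l))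
                (filter-internal-map right isInternalPos-right (allPos r)))

length-internal-allPos : (t : BTree) → length (filter IsInternal? (allPos t)) ≡ internals t
length-internal-allPos leaf       = refl
length-internal-allPos (node l r) = cong suc (begin
  length (filter IsInternal? (map left (allPos l) ++ map right (allPos r)))  ≡⟨ cong length (filter-internal-children {l} {r}) ⟩
  length (map left Il ++ map right Ir)                                       ≡⟨ List.length-++ (map left Il) ⟩
  length (map left Il) + length (map right Ir)
    ≡⟨ cong₂ _+_ (List.length-map left Il) (List.length-map right Ir) ⟩
  length Il + length Ir
    ≡⟨ cong₂ _+_ (length-internal-allPos l) (length-internal-allPos r) ⟩
  internals l + internals r                                                  ∎)
  where
  open ≡-Reasoning
  Il = filter IsInternal? (allPos l)
  Ir = filter IsInternal? (allPos r)

-- Each internal node of l lies one level deeper in node l r than in l.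
H-node : (l r : BTree) → H (node l r) ≡ (internals l + H l) + (internals r + H r)
H-node l r = begin
  H (node l r)                                               ≡⟨ cong (sum ∘ map rootDist) (filter-internal-children {l} {r}) ⟩
  sum (map rootDist (map left Il ++ map right Ir))           ≡⟨ sum-map-++ rootDist (map left Il) (map right Ir) ⟩
  sum (map rootDist (map left Il)) + sum (map rootDist (map right Ir))
    ≡⟨ cong₂ _+_ (sum-rootDist-map left (rootDist-left {r = r}) Il) (sum-rootDist-map right (rootDist-right {l = l}) Ir) ⟩
  (length Il + H l) + (length Ir + H r)
    ≡⟨ cong₂ (λ a b → (a + H l) + (b + H r)) (length-internal-allPos l) (length-internal-allPos r) ⟩
  (internals l + H l) + (internals r + H r)                  ∎
  where
  open ≡-Reasoning
  Il = filter IsInternal? (allPos l)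
  Ir = filter IsInternal? (allPos r)

-- A clade with k internal nodes contains at most k clusters, each one level deeper than inside the clade.
clade-lcaDepths-≤ : (p : Pos t → Bool) (f : Pos t → Pos t′) (F : List (RG t)) →
  ((F′ : List (RG t′)) → Distinct (leafSpeciesL F′) → All IsLeafPos (leafSpeciesL F′) →
     sum (map lcaDepth (clustersL F′)) ≤ H t′) →
  Distinct (map f (filterᵇ p (leafSpeciesL F))) → All IsLeafPos (map f (filterᵇ p (leafSpeciesL F))) →
  sum (map (suc ∘ lcaDepth ∘ map f) (filterᵇ (all p) (clustersL F))) ≤ internals t′ + H t′
clade-lcaDepths-≤ {t′ = t′} p f F bound d a = begin
  sum (map (suc ∘ lcaDepth ∘ map f) 𝒞)                        ≡⟨ sum-map-suc (lcaDepth ∘ map f) 𝒞 ⟩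
  length 𝒞 + sum (map (lcaDepth ∘ map f) 𝒞)
    ≡⟨ cong₂ _+_ (sym (List.length-map (map f) 𝒞)) (cong sum (List.map-∘ 𝒞)) ⟩
  length (map (map f) 𝒞) + sum (map lcaDepth (map (map f) 𝒞))
    ≡⟨ cong (λ 𝒟 → length 𝒟 + sum (map lcaDepth 𝒟)) (clusters-restrictL F) ⟨
  length (clustersL F′) + sum (map lcaDepth (clustersL F′))    ≤⟨ ℕ.+-mono-≤ length-≤ (bound F′ d′ a′) ⟩
  internals t′ + H t′                                          ∎
  where
  open ℕ.≤-Reasoning
  open Restriction p f
  𝒞 = filterᵇ (all p) (clustersL F)
  F′ = restrictL F
  d′ : Distinct (leafSpeciesL F′)
  d′ = subst Distinct (sym (leafSpecies-restrictL F)) d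
  a′ : All IsLeafPos (leafSpeciesL F′)
  a′ = subst (All IsLeafPos) (sym (leafSpecies-restrictL F)) a
  length-≤ : length (clustersL F′) ≤ internals t′
  length-≤ = clustersL-length-≤ F′
    (subst (length (leafSpeciesL F′) ≤_) (leafCount≡1+internals t′) (Distinct-leaves-≤ t′ _ d′ a′))

lcaDepths-≤-H : (t : BTree) (F : List (RG t)) → Distinct (leafSpeciesL F) → All IsLeafPos (leafSpeciesL F) →
  sum (map lcaDepth (clustersL F)) ≤ H t
lcaDepths-≤-H leaf       F _ _ = ℕ.≤-reflexive (sum-zeros (clustersL F))
  where
  sum-zeros : (𝒞 : List (List (Pos leaf))) → sum (map lcaDepth 𝒞) ≡ 0
  sum-zeros []       = refl
  sum-zeros (_ ∷ 𝒞) = sum-zeros 𝒞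
lcaDepths-≤-H (node l r) F d a = begin
  sum (map lcaDepth 𝒞)
    ≤⟨ sum-map-if-≤ (all isLeft) (all isRight) (suc ∘ lcaDepth ∘ map fromLeft) (suc ∘ lcaDepth ∘ map fromRight) 𝒞 ⟩
  sum (map (suc ∘ lcaDepth ∘ map fromLeft) (filterᵇ (all isLeft) 𝒞)) +
  sum (map (suc ∘ lcaDepth ∘ map fromRight) (filterᵇ (all isRight) 𝒞))
    ≤⟨ ℕ.+-mono-≤ (clade-lcaDepths-≤ isLeft fromLeft F (lcaDepths-≤-H l)
                     (Distinct-leftPart (leafSpeciesL F) d) (leftPart-IsLeafPos a))
                  (clade-lcaDepths-≤ isRight fromRight F (lcaDepths-≤-H r)
                     (Distinct-rightPart (leafSpeciesL F) d) (rightPart-IsLeafPos a)) ⟩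
  (internals l + H l) + (internals r + H r)
    ≡⟨ H-node l r ⟨
  H (node l r) ∎
  where
  open ℕ.≤-Reasoning
  𝒞 = clustersL F

count≡0⊎IsLeafPos : (s : Pos t) (X : List (Pos t)) → All IsLeafPos X → count s X ≡ 0 ⊎ IsLeafPos s
count≡0⊎IsLeafPos s []      []       = inj₁ refl
count≡0⊎IsLeafPos s (x ∷ X) (p ∷ ps) with x ≟Pos s
... | yes refl = inj₂ p
... | no _     = count≡0⊎IsLeafPos s X ps

module _ {G : RG S} (G∈ : InGS S G) where

  InGS-IsLeafPos : All IsLeafPos (leafSpecies G)
  InGS-IsLeafPos = leafSpecies-IsLeafPos (proj₁ G∈)

  InGS-Distinct : Distinct (leafSpecies G)
  InGS-Distinct s with count≡0⊎IsLeafPos s (leafSpecies G) InGS-IsLeafPos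
  ... | inj₁ c≡0 rewrite c≡0 = z≤n
  ... | inj₂ s∈S rewrite proj₂ G∈ s s∈S = s≤s z≤n

  InGS-⊆ᵇ : {G′ : RG S} → InGS S G′ → leafSpecies G ⊆ᵇ leafSpecies G′
  InGS-⊆ᵇ {G′} G′∈ = All.map
    (λ {s} s∈S → count>0⇒∈ᵇ s (leafSpecies G′) (subst (0 <_) (sym (proj₂ G′∈ s s∈S)) (s≤s z≤n)))
    InGS-IsLeafPos

module _ {G₁ G₂ : RG S} (G₁∈ : InGS S G₁) (G₂∈ : InGS S G₂) where

  dpath-≤-H : dpath G₁ G₂ ≤ H S
  dpath-≤-H = ℕ.≤-trans (dpath-≤-lcaDepths (proj₁ G₂∈) (proj₁ G₁∈) (InGS-⊆ᵇ G₁∈ G₂∈))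
    (subst (λ 𝒞 → sum (map lcaDepth 𝒞) ≤ H S) (List.++-identityʳ (clusters G₁))
      (lcaDepths-≤-H S (G₁ ∷ [])
        (subst Distinct (sym (List.++-identityʳ (leafSpecies G₁))) (InGS-Distinct G₁∈))
        (subst (All IsLeafPos) (sym (List.++-identityʳ (leafSpecies G₁))) (InGS-IsLeafPos G₁∈))))

  dlbl-≤-internals : dlbl G₁ G₂ ≤ internals S
  dlbl-≤-internals = ℕ.≤-trans (dlbl-≤-#clusters (proj₁ G₂∈) (proj₁ G₁∈) (InGS-⊆ᵇ G₁∈ G₂∈))
    (ℕ.≤-pred (ℕ.≤-trans (clusters-length G₁)
      (subst (length (leafSpecies G₁) ≤_) (leafCount≡1+internals S)
        (Distinct-leaves-≤ S _ (InGS-Distinct G₁∈) (InGS-IsLeafPos G₁∈)))))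

-- The extremal pair

speciesTree : (t : BTree) → RG t
speciesTree leaf       = gleaf here extant
speciesTree (node l r) = gnode here spec (mapRG left (speciesTree l)) (mapRG right (speciesTree r)) []

mutual
  dupAtRoot : RG S → RG S
  dupAtRoot (gleaf s a)          = gleaf s a
  dupAtRoot (gnode s a c₁ c₂ cs) = gnode here dup (dupAtRoot c₁) (dupAtRoot c₂) (dupAtRootL cs)

  dupAtRootL : List (RG S) → List (RG S)
  dupAtRootL []       = []
  dupAtRootL (c ∷ cs) = dupAtRoot c ∷ dupAtRootL cs

Binary-mapRG : (f : Pos t → Pos t′) {g : RG t} → Binary g → Binary (mapRG f g)
Binary-mapRG f binary-leaf         = binary-leaf
Binary-mapRG f (binary-node b₁ b₂) = binary-node (Binary-mapRG f b₁) (Binary-mapRG f b₂)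

Binary-speciesTree : (t : BTree) → Binary (speciesTree t)
Binary-speciesTree leaf       = binary-leaf
Binary-speciesTree (node l r) = binary-node (Binary-mapRG left (Binary-speciesTree l)) (Binary-mapRG right (Binary-speciesTree r))

μ-mapRG : (f : Pos t → Pos t′) (g : RG t) → μ (mapRG f g) ≡ f (μ g)
μ-mapRG f (gleaf _ _)         = refl
μ-mapRG f (gnode _ _ _ _ _) = refl

μ-speciesTree : (t : BTree) → μ (speciesTree t) ≡ here
μ-speciesTree leaf       = refl
μ-speciesTree (node l r) = refl

nodes-mapRG : (f : Pos t → Pos t′) {g : RG t} → Binary g → nodes (mapRG f g) ≡ map (mapRG f) (nodes g)
nodes-mapRG f {gleaf _ _} binary-leaf = refl
nodes-mapRG f {gnode _ _ c₁ c₂ []} (binary-node b₁ b₂)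
  rewrite nodes-mapRG f b₁ | nodes-mapRG f b₂
        | List.map-++ (mapRG f) (nodes c₁) (nodes c₂ ++ []) | List.map-++ (mapRG f) (nodes c₂) [] = refl

mapRG-Valid : (f : Pos t → Pos t′) →
  (∀ {p} → IsLeafPos p → IsLeafPos (f p)) → (∀ {p q} → p ⪯ q → f p ⪯ f q) →
  (∀ {s a b} → Sep s a b → Sep (f s) (f a) (f b)) →
  {g : RG t} → Binary g → Valid g → Valid (mapRG f g)
mapRG-Valid f f-leaf f-⪯ f-Sep binary-leaf (valid-leaf l) = valid-leaf (f-leaf l)
mapRG-Valid f f-leaf f-⪯ f-Sep {gnode s _ c₁ c₂ []} (binary-node b₁ b₂) (valid-node a≢ p₁ p₂ [] v₁ v₂ [] sep) =
  valid-node a≢ (subst (_⪯ f s) (sym (μ-mapRG f c₁)) (f-⪯ p₁)) (subst (_⪯ f s) (sym (μ-mapRG f c₂)) (f-⪯ p₂)) []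
    (mapRG-Valid f f-leaf f-⪯ f-Sep b₁ v₁) (mapRG-Valid f f-leaf f-⪯ f-Sep b₂ v₂) []
    (λ a≡spec → refl , subst₂ (Sep (f s)) (sym (μ-mapRG f c₁)) (sym (μ-mapRG f c₂)) (f-Sep (proj₂ (sep a≡spec))))

speciesTree-Valid : (t : BTree) → Valid (speciesTree t)
speciesTree-Valid leaf       = valid-leaf leaf-here
speciesTree-Valid (node l r) =
  valid-node (λ ()) ⪯-here ⪯-here []
    (mapRG-Valid left leaf-left ⪯-left sep-left (Binary-speciesTree l) (speciesTree-Valid l))
    (mapRG-Valid right leaf-right ⪯-right sep-right (Binary-speciesTree r) (speciesTree-Valid r)) []
    (λ _ → refl , subst₂ (Sep here) (sym (trans (μ-mapRG left (speciesTree l)) (cong left (μ-speciesTree l))))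
                                     (sym (trans (μ-mapRG right (speciesTree r)) (cong right (μ-speciesTree r)))) sep-lr)

module _ {l r : BTree} where

  count-map-left : (s : Pos l) (X : List (Pos l)) → count (left {r = r} s) (map left X) ≡ count s X
  count-map-left s []      = refl
  count-map-left s (x ∷ X) with x ≟Pos s
  ... | yes refl = cong suc (count-map-left s X)
  ... | no _     = count-map-left s X

  count-map-right : (s : Pos r) (X : List (Pos r)) → count (right {l = l} s) (map right X) ≡ count s X
  count-map-right s []      = refl
  count-map-right s (x ∷ X) with x ≟Pos s
  ... | yes refl = cong suc (count-map-right s X)
  ... | no _     = count-map-right s X

  count-left-map-right : (s : Pos l) (X : List (Pos r)) → count (left s) (map right X) ≡ 0
  count-left-map-right s []      = refl
  count-left-map-right s (x ∷ X) rewrite count-∷-≢ {s = left s} {x = right x} (map right X) (λ ()) = count-left-map-right s X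

  count-right-map-left : (s : Pos r) (X : List (Pos l)) → count (right s) (map left X) ≡ 0
  count-right-map-left s []      = refl
  count-right-map-left s (x ∷ X) rewrite count-∷-≢ {s = right s} {x = left x} (map left X) (λ ()) = count-right-map-left s X

  leafSpecies-speciesTree : leafSpecies (speciesTree (node l r)) ≡
    map left (leafSpecies (speciesTree l)) ++ map right (leafSpecies (speciesTree r))
  leafSpecies-speciesTree = cong₂ _++_ (leafSpecies-mapRG left (speciesTree l))
    (trans (List.++-identityʳ _) (leafSpecies-mapRG right (speciesTree r)))

count-speciesTree : (s : Pos t) → IsLeafPos s → count s (leafSpecies (speciesTree t)) ≡ 1
count-speciesTree here leaf-here = refl
count-speciesTree {node l r} (left s) (leaf-left p) = begin
  count (left s) (leafSpecies (speciesTree (node l r)))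
    ≡⟨ cong (count (left s)) (leafSpecies-speciesTree {l} {r}) ⟩
  count (left s) (map left Ll ++ map right Lr)
    ≡⟨ count-++ (left s) (map left Ll) (map right Lr) ⟩
  count (left s) (map left Ll) + count (left s) (map right Lr)
    ≡⟨ cong₂ _+_ (count-map-left s Ll) (count-left-map-right s Lr) ⟩
  count s Ll + 0
    ≡⟨ cong (_+ 0) (count-speciesTree s p) ⟩
  1 ∎
  where
  open ≡-Reasoning
  Ll = leafSpecies (speciesTree l)
  Lr = leafSpecies (speciesTree r)
count-speciesTree {node l r} (right s) (leaf-right p) = begin
  count (right s) (leafSpecies (speciesTree (node l r)))
    ≡⟨ cong (count (right s)) (leafSpecies-speciesTree {l} {r}) ⟩
  count (right s) (map left Ll ++ map right Lr)
    ≡⟨ count-++ (right s) (map left Ll) (map right Lr) ⟩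
  count (right s) (map left Ll) + count (right s) (map right Lr)
    ≡⟨ cong₂ _+_ (count-right-map-left s Ll) (count-map-right s Lr) ⟩
  count s Lr
    ≡⟨ count-speciesTree s p ⟩
  1 ∎
  where
  open ≡-Reasoning
  Ll = leafSpecies (speciesTree l)
  Lr = leafSpecies (speciesTree r)

InGS-speciesTree : (t : BTree) → InGS t (speciesTree t)
InGS-speciesTree t = speciesTree-Valid t , count-speciesTree

mutual
  leafSpecies-dupAtRoot : (g : RG S) → leafSpecies (dupAtRoot g) ≡ leafSpecies g
  leafSpecies-dupAtRoot (gleaf s a)          = refl
  leafSpecies-dupAtRoot (gnode s a c₁ c₂ cs)
    rewrite leafSpecies-dupAtRoot c₁ | leafSpecies-dupAtRoot c₂ | leafSpeciesL-dupAtRoot cs = refl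

  leafSpeciesL-dupAtRoot : (cs : List (RG S)) → leafSpeciesL (dupAtRootL cs) ≡ leafSpeciesL cs
  leafSpeciesL-dupAtRoot []       = refl
  leafSpeciesL-dupAtRoot (c ∷ cs) rewrite leafSpecies-dupAtRoot c | leafSpeciesL-dupAtRoot cs = refl

covers-cong : {g h : RG S} → leafSpecies g ≡ leafSpecies h → (X : List (Pos S)) → covers g X ≡ covers h X
covers-cong e []      = refl
covers-cong e (x ∷ X) = cong₂ (λ L b → (x ∈ᵇ L) ∧ b) e (covers-cong e X)

covers-dupAtRoot : (g : RG S) (X : List (Pos S)) → covers (dupAtRoot g) X ≡ covers g X
covers-dupAtRoot g = covers-cong {g = dupAtRoot g} {h = g} (leafSpecies-dupAtRoot g)

mutual
  lca-dupAtRoot : (g : RG S) (X : List (Pos S)) → lca (dupAtRoot g) X ≡ dupAtRoot (lca g X)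
  lca-dupAtRoot (gleaf s a) X = refl
  lca-dupAtRoot (gnode s a c₁ c₂ cs) X
    rewrite covers-dupAtRoot c₁ X | covers-dupAtRoot c₂ X
    with covers c₁ X | covers c₂ X
  ... | true  | _     = lca-dupAtRoot c₁ X
  ... | false | true  = lca-dupAtRoot c₂ X
  ... | false | false = lcaL-dupAtRoot cs X (gnode s a c₁ c₂ cs)

  lcaL-dupAtRoot : (cs : List (RG S)) (X : List (Pos S)) (d : RG S) →
    lcaL (dupAtRootL cs) X (dupAtRoot d) ≡ dupAtRoot (lcaL cs X d)
  lcaL-dupAtRoot []       X d = refl
  lcaL-dupAtRoot (c ∷ cs) X d rewrite covers-dupAtRoot c X with covers c X
  ... | true  = lca-dupAtRoot c X
  ... | false = lcaL-dupAtRoot cs X d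

dupAtRoot-Valid : {g : RG S} → Binary g → Valid g → Valid (dupAtRoot g)
dupAtRoot-Valid binary-leaf         v = v
dupAtRoot-Valid (binary-node b₁ b₂) (valid-node _ _ _ [] v₁ v₂ [] _) =
  valid-node (λ ()) ⪯-here ⪯-here [] (dupAtRoot-Valid b₁ v₁) (dupAtRoot-Valid b₂ v₂) [] (λ ())

nodes-dupAtRoot : {g : RG S} → Binary g → nodes (dupAtRoot g) ≡ map dupAtRoot (nodes g)
nodes-dupAtRoot {g = gleaf _ _} binary-leaf = refl
nodes-dupAtRoot {g = gnode _ _ c₁ c₂ []} (binary-node b₁ b₂)
  rewrite nodes-dupAtRoot b₁ | nodes-dupAtRoot b₂
        | List.map-++ dupAtRoot (nodes c₁) (nodes c₂ ++ []) | List.map-++ dupAtRoot (nodes c₂) [] = refl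

InGS-dupAtRoot : {g : RG S} → Binary g → InGS S g → InGS S (dupAtRoot g)
InGS-dupAtRoot {g = g} b (v , once) =
  dupAtRoot-Valid b v , λ s s∈S → trans (cong (count s) (leafSpecies-dupAtRoot g)) (once s s∈S)

lca-nodes : {g : RG S} → Binary g → Distinct (leafSpecies g) → All (λ v → lca g (leafSpecies v) ≡ v) (nodes g)
lca-nodes {g = gleaf _ _} binary-leaf _ = refl ∷ []
lca-nodes {g = g@(gnode s a c₁ c₂ [])} (binary-node b₁ b₂) d =
  lca-stop (leafSpecies g) c₁∌ c₂∌ ∷ AllP.++⁺ in-c₁ (AllP.++⁺ in-c₂ [])
  where
  A  = leafSpecies c₁
  L₂ = leafSpecies c₂
  B  = L₂ ++ []
  B≡L₂ : B ≡ L₂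
  B≡L₂ = List.++-identityʳ L₂
  ∉A : {x : Pos _} → x ∈ᵇ L₂ ≡ true → x ∈ᵇ A ≡ false
  ∉A x∈ = Distinct-++⇒∉ᵇˡ A B d (subst (λ Y → _ ∈ᵇ Y ≡ true) (sym B≡L₂) x∈)
  c₁∌ : covers c₁ (leafSpecies g) ≡ false
  c₁∌ with x , x∈ ← leafSpecies-inhabited c₂ =
    ¬covers c₁ (leafSpecies g) (∈ᵇ-++⁺ʳ A B (∈ᵇ-++⁺ˡ L₂ [] x∈)) (∉A x∈)
  c₂∌ : covers c₂ (leafSpecies g) ≡ false
  c₂∌ with x , x∈ ← leafSpecies-inhabited c₁ =
    ¬covers c₂ (leafSpecies g) (∈ᵇ-++⁺ˡ A B x∈)
      (subst (λ Y → _ ∈ᵇ Y ≡ false) B≡L₂ (Distinct-++⇒∉ᵇʳ A B d x∈))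
  in-c₁ : All (λ v → lca g (leafSpecies v) ≡ v) (nodes c₁)
  in-c₁ = All.zipWith
            (λ { {v} (v⊆ , self) →
                 trans (lca-descend₁ {s = s} {a} {c₁} {c₂} (leafSpecies v) (⊆ᵇ⇒covers c₁ v⊆)) self })
            (nodes-⊆ᵇ c₁ , lca-nodes b₁ (Distinct-++⁻ˡ A B d))
  in-c₂ : All (λ v → lca g (leafSpecies v) ≡ v) (nodes c₂)
  in-c₂ = All.zipWith
            (λ { {v} (v⊆ , self) →
                 trans (lca-descend₂ {s = s} {a} {c₁} {c₂} (leafSpecies v) (c₁∌v v v⊆) (⊆ᵇ⇒covers c₂ v⊆)) self })
            (nodes-⊆ᵇ c₂ , lca-nodes b₂ (Distinct-++⁻ˡ L₂ [] (Distinct-++⁻ʳ A B d)))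
    where
    c₁∌v : (v : RG _) → leafSpecies v ⊆ᵇ L₂ → covers c₁ (leafSpecies v) ≡ false
    c₁∌v v v⊆ with x , x∈ ← leafSpecies-inhabited v = ¬covers c₁ (leafSpecies v) x∈ (∉A (All-∈ᵇ v⊆ x∈))

sum-map-+ : {A : Set} (f g : A → ℕ) (xs : List A) → sum (map (λ x → f x + g x) xs) ≡ sum (map f xs) + sum (map g xs)
sum-map-+ f g []       = refl
sum-map-+ f g (x ∷ xs) = trans (cong (f x + g x +_) (sum-map-+ f g xs)) (interchange (f x) (g x) _ _)

sum-map-cong : {A : Set} {f g : A → ℕ} {xs : List A} → All (λ x → f x ≡ g x) xs → sum (map f xs) ≡ sum (map g xs)
sum-map-cong = cong sum ∘ List.map-cong-local

sum-map-nodes-mapRG : (f : Pos t → Pos t′) (w : RG t′ → ℕ) {g : RG t} → Binary g →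
  sum (map w (nodes (mapRG f g))) ≡ sum (map (w ∘ mapRG f) (nodes g))
sum-map-nodes-mapRG f w {g} b = cong sum (trans (cong (map w) (nodes-mapRG f b)) (sym (List.map-∘ (nodes g))))

sum-map-nodes-speciesTree : {l r : BTree} (w : RG (node l r) → ℕ) →
  sum (map w (nodes (speciesTree (node l r)))) ≡
  w (speciesTree (node l r)) +
  (sum (map (w ∘ mapRG left) (nodes (speciesTree l))) + sum (map (w ∘ mapRG right) (nodes (speciesTree r))))
sum-map-nodes-speciesTree {l} {r} w = cong (w (speciesTree (node l r)) +_) (begin
  sum (map w (nodes Tl ++ nodes Tr ++ []))
    ≡⟨ sum-map-++ w (nodes Tl) _ ⟩
  sum (map w (nodes Tl)) + sum (map w (nodes Tr ++ []))
    ≡⟨ cong (λ ns → sum (map w (nodes Tl)) + sum (map w ns)) (List.++-identityʳ (nodes Tr)) ⟩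
  sum (map w (nodes Tl)) + sum (map w (nodes Tr))
    ≡⟨ cong₂ _+_ (sum-map-nodes-mapRG left w (Binary-speciesTree l)) (sum-map-nodes-mapRG right w (Binary-speciesTree r)) ⟩
  sum (map (w ∘ mapRG left) (nodes (speciesTree l))) + sum (map (w ∘ mapRG right) (nodes (speciesTree r))) ∎)
  where
  open ≡-Reasoning
  Tl = mapRG left (speciesTree l)
  Tr = mapRG right (speciesTree r)

sum-internal-speciesTree : (w : {u : BTree} → RG u → ℕ) →
  (∀ {u u′} (f : Pos u → Pos u′) v → w (mapRG f v) ≡ w v) →
  w (speciesTree leaf) ≡ 0 → (∀ {l r} → w (speciesTree (node l r)) ≡ 1) →
  (t : BTree) → sum (map w (nodes (speciesTree t))) ≡ internals t
sum-internal-speciesTree w w-mapRG w-leaf w-node leaf       = cong (_+ 0) w-leaf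
sum-internal-speciesTree w w-mapRG w-leaf w-node (node l r) = begin
  sum (map w (nodes (speciesTree (node l r))))
    ≡⟨ sum-map-nodes-speciesTree w ⟩
  w (speciesTree (node l r)) + (sum (map (w ∘ mapRG left) Nl) + sum (map (w ∘ mapRG right) Nr))
    ≡⟨ cong₂ _+_ w-node (cong₂ _+_ (cong sum (List.map-cong (w-mapRG left) Nl))
                                    (cong sum (List.map-cong (w-mapRG right) Nr))) ⟩
  1 + (sum (map w Nl) + sum (map w Nr))
    ≡⟨ cong (λ k → 1 + k) (cong₂ _+_ (sum-internal-speciesTree w w-mapRG w-leaf w-node l)
                                     (sum-internal-speciesTree w w-mapRG w-leaf w-node r)) ⟩
  suc (internals l + internals r)  ∎
  where
  open ≡-Reasoning
  Nl = nodes (speciesTree l)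
  Nr = nodes (speciesTree r)

sum-atInternal-speciesTree : (t : BTree) → sum (map (atInternal (λ _ → 1)) (nodes (speciesTree t))) ≡ internals t
sum-atInternal-speciesTree = sum-internal-speciesTree (atInternal (λ _ → 1)) atInternal-mapRG refl refl
  where
  atInternal-mapRG : ∀ {u u′} (f : Pos u → Pos u′) v → atInternal (λ _ → 1) (mapRG f v) ≡ atInternal (λ _ → 1) v
  atInternal-mapRG f (gleaf _ _)         = refl
  atInternal-mapRG f (gnode _ _ _ _ _) = refl

depthAtInternal : RG S → ℕ
depthAtInternal (gleaf _ _)         = 0
depthAtInternal (gnode s _ _ _ _) = depth s

sum-depthAtInternal-speciesTree : (t : BTree) → sum (map depthAtInternal (nodes (speciesTree t))) ≡ H t
sum-depthAtInternal-speciesTree leaf       = refl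
sum-depthAtInternal-speciesTree (node l r) = begin
  sum (map depthAtInternal (nodes (speciesTree (node l r))))
    ≡⟨ sum-map-nodes-speciesTree {l} {r} depthAtInternal ⟩
  sum (map (depthAtInternal ∘ mapRG left) (nodes (speciesTree l))) +
  sum (map (depthAtInternal ∘ mapRG right) (nodes (speciesTree r)))
    ≡⟨ cong₂ _+_ (clade left {λ _ → refl} (sum-depthAtInternal-speciesTree l))
                 (clade right {λ _ → refl} (sum-depthAtInternal-speciesTree r)) ⟩
  (internals l + H l) + (internals r + H r)
    ≡⟨ H-node l r ⟨
  H (node l r) ∎
  where
  open ≡-Reasoning
  clade : {u : BTree} (f : Pos u → Pos (node l r)) {f-depth : ∀ p → depth (f p) ≡ suc (depth p)} →
    sum (map depthAtInternal (nodes (speciesTree u))) ≡ H u →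
    sum (map (depthAtInternal ∘ mapRG f) (nodes (speciesTree u))) ≡ internals u + H u
  clade {u} f {f-depth} ih = begin
    sum (map (depthAtInternal ∘ mapRG f) N)                          ≡⟨ cong sum (List.map-cong one-deeper N) ⟩
    sum (map (λ v → atInternal (λ _ → 1) v + depthAtInternal v) N)  ≡⟨ sum-map-+ (atInternal (λ _ → 1)) depthAtInternal N ⟩
    sum (map (atInternal (λ _ → 1)) N) + sum (map depthAtInternal N) ≡⟨ cong₂ _+_ (sum-atInternal-speciesTree u) ih ⟩
    internals u + H u                                                ∎
    where
    N = nodes (speciesTree u)
    one-deeper : (v : RG u) → depthAtInternal (mapRG f v) ≡ atInternal (λ _ → 1) v + depthAtInternal v
    one-deeper (gleaf _ _)         = refl
    one-deeper (gnode s _ _ _ _) = f-depth s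

dist-μ-dupAtRoot : (v : RG S) → dist (μ v) (μ (dupAtRoot v)) ≡ depthAtInternal v
dist-μ-dupAtRoot (gleaf s _)         = dist-self s
dist-μ-dupAtRoot (gnode s _ _ _ _) = dist-here s

dist-μ-dupAtRoot′ : (v : RG S) → dist (μ (dupAtRoot v)) (μ v) ≡ depthAtInternal v
dist-μ-dupAtRoot′ (gleaf s _)         = dist-self s
dist-μ-dupAtRoot′ (gnode s _ _ _ _) = refl

module Witness (t : BTree) where

  G₁ G₂ : RG t
  G₁ = speciesTree t
  G₂ = dupAtRoot G₁

  lca-self : All (λ v → lca G₁ (leafSpecies v) ≡ v) (nodes G₁)
  lca-self = lca-nodes (Binary-speciesTree t) (InGS-Distinct (InGS-speciesTree t))

  m-G₂ : All (λ v → m G₂ v ≡ dupAtRoot v) (nodes G₁)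
  m-G₂ = All.map (λ {v} e → trans (lca-dupAtRoot G₁ (leafSpecies v)) (cong dupAtRoot e)) lca-self

  m-G₁ : All (λ v → m G₁ (dupAtRoot v) ≡ v) (nodes G₁)
  m-G₁ = All.map (λ {v} e → trans (cong (lca G₁) (leafSpecies-dupAtRoot v)) e) lca-self

  sum-nodes-G₂ : (w : RG t → ℕ) → sum (map w (nodes G₂)) ≡ sum (map (w ∘ dupAtRoot) (nodes G₁))
  sum-nodes-G₂ w = cong sum (trans (cong (map w) (nodes-dupAtRoot (Binary-speciesTree t))) (sym (List.map-∘ (nodes G₁))))

  dpath-G₁G₂ : dpath G₁ G₂ ≡ H t
  dpath-G₁G₂ = trans
    (sum-map-cong (All.map (λ {v} e → trans (cong (dist (μ v) ∘ μ) e) (dist-μ-dupAtRoot v)) m-G₂))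
    (sum-depthAtInternal-speciesTree t)

  dpath-G₂G₁ : dpath G₂ G₁ ≡ H t
  dpath-G₂G₁ = trans (sum-nodes-G₂ _) (trans
    (sum-map-cong (All.map (λ {v} e → trans (cong (dist (μ (dupAtRoot v)) ∘ μ) e) (dist-μ-dupAtRoot′ v)) m-G₁))
    (sum-depthAtInternal-speciesTree t))

  dlbl-G₁G₂ : dlbl G₁ G₂ ≡ internals t
  dlbl-G₁G₂ = trans (sum-map-cong (All.map (λ {v} e → cong (mismatch (lab v) ∘ lab) e) m-G₂))
    (sum-internal-speciesTree (λ v → mismatch (lab v) (lab (dupAtRoot v))) invariant refl refl t)
    where
    invariant : ∀ {u u′} (f : Pos u → Pos u′) v →
      mismatch (lab (mapRG f v)) (lab (dupAtRoot (mapRG f v))) ≡ mismatch (lab v) (lab (dupAtRoot v))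
    invariant f (gleaf _ _)         = refl
    invariant f (gnode _ _ _ _ _) = refl

  dlbl-G₂G₁ : dlbl G₂ G₁ ≡ internals t
  dlbl-G₂G₁ = trans (sum-nodes-G₂ _) (trans
    (sum-map-cong (All.map (λ {v} e → cong (mismatch (lab (dupAtRoot v)) ∘ lab) e) m-G₁))
    (sum-internal-speciesTree (λ v → mismatch (lab (dupAtRoot v)) (lab v)) invariant refl refl t))
    where
    invariant : ∀ {u u′} (f : Pos u → Pos u′) v →
      mismatch (lab (dupAtRoot (mapRG f v))) (lab (mapRG f v)) ≡ mismatch (lab (dupAtRoot v)) (lab v)
    invariant f (gleaf _ _)         = refl
    invariant f (gnode _ _ _ _ _) = refl

  InGS-G₁ : InGS t G₁
  InGS-G₁ = InGS-speciesTree t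

  InGS-G₂ : InGS t G₂
  InGS-G₂ = InGS-dupAtRoot (Binary-speciesTree t) InGS-G₁

-- Caterpillars maximise H

-- 2 H(t) ≤ i (i − 1) for i = internals t, written without truncated subtraction.
H-bound : (t : BTree) → (H t + H t) + (internals t + internals t) ≤ internals t * suc (internals t)
H-bound leaf       = z≤n
H-bound (node l r) rewrite H-node l r = begin
  (a + x + (b + y)) + (a + x + (b + y)) + (suc (a + b) + suc (a + b))
    ≡⟨ regroup a b x y ⟩
  ((x + x) + (a + a)) + ((y + y) + (b + b)) + (a + a + (b + b) + 2)
    ≤⟨ ℕ.+-monoˡ-≤ _ (ℕ.+-mono-≤ (H-bound l) (H-bound r)) ⟩
  a * suc a + b * suc b + (a + a + (b + b) + 2)
    ≤⟨ ℕ.m≤m+n _ (2 * (a * b)) ⟩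
  a * suc a + b * suc b + (a + a + (b + b) + 2) + 2 * (a * b)
    ≡⟨ expand a b ⟩
  suc (a + b) * suc (suc (a + b)) ∎
  where
  open ℕ.≤-Reasoning
  open +-*-Solver
  a = internals l
  b = internals r
  x = H l
  y = H r
  regroup : ∀ a b x y → (a + x + (b + y)) + (a + x + (b + y)) + (suc (a + b) + suc (a + b)) ≡
                        ((x + x) + (a + a)) + ((y + y) + (b + b)) + (a + a + (b + b) + 2)
  regroup = solve 4 (λ a b x y →
    (a :+ x :+ (b :+ y)) :+ (a :+ x :+ (b :+ y)) :+ ((con 1 :+ (a :+ b)) :+ (con 1 :+ (a :+ b))) :=
    ((x :+ x) :+ (a :+ a)) :+ ((y :+ y) :+ (b :+ b)) :+ (a :+ a :+ (b :+ b) :+ con 2)) refl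
  expand : ∀ a b → a * suc a + b * suc b + (a + a + (b + b) + 2) + 2 * (a * b) ≡ suc (a + b) * suc (suc (a + b))
  expand = solve 2 (λ a b →
    a :* (con 1 :+ a) :+ b :* (con 1 :+ b) :+ (a :+ a :+ (b :+ b) :+ con 2) :+ con 2 :* (a :* b) :=
    (con 1 :+ (a :+ b)) :* (con 1 :+ (con 1 :+ (a :+ b)))) refl

spine-regroup : ∀ b y → (b + y) + (b + y) + (suc b + suc b) ≡ (y + y + (b + b)) + 2 * suc b
spine-regroup = solve 2 (λ b y → (b :+ y) :+ (b :+ y) :+ ((con 1 :+ b) :+ (con 1 :+ b)) :=
                                 (y :+ y :+ (b :+ b)) :+ con 2 :* (con 1 :+ b)) refl
  where open +-*-Solver

spine-expand : ∀ b → b * suc b + 2 * suc b ≡ suc b * suc (suc b)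
spine-expand = solve 1 (λ b → b :* (con 1 :+ b) :+ con 2 :* (con 1 :+ b) := (con 1 :+ b) :* (con 1 :+ (con 1 :+ b))) refl
  where open +-*-Solver

H-bound-caterpillar : {t : BTree} → IsCaterpillar t → (H t + H t) + (internals t + internals t) ≡ internals t * suc (internals t)
H-bound-caterpillar cat-leaf = refl
H-bound-caterpillar (cat-nodeˡ {r} c) rewrite H-node leaf r = begin
  (b + y) + (b + y) + (suc b + suc b)  ≡⟨ spine-regroup b y ⟩
  (y + y + (b + b)) + 2 * suc b        ≡⟨ cong (_+ 2 * suc b) (H-bound-caterpillar c) ⟩
  b * suc b + 2 * suc b                ≡⟨ spine-expand b ⟩
  suc b * suc (suc b)                  ∎
  where
  open ≡-Reasoning
  b = internals r
  y = H r
H-bound-caterpillar (cat-nodeʳ {l} c) rewrite H-node l leaf | ℕ.+-identityʳ (internals l) | ℕ.+-identityʳ (internals l + H l) = begin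
  (a + x) + (a + x) + (suc a + suc a)  ≡⟨ spine-regroup a x ⟩
  (x + x + (a + a)) + 2 * suc a        ≡⟨ cong (_+ 2 * suc a) (H-bound-caterpillar c) ⟩
  a * suc a + 2 * suc a                ≡⟨ spine-expand a ⟩
  suc a * suc (suc a)                  ∎
  where
  open ≡-Reasoning
  a = internals l
  x = H l

m+m≤n+n⇒m≤n : {a b : ℕ} → a + a ≤ b + b → a ≤ b
m+m≤n+n⇒m≤n {a} {b} 2a≤2b with a ℕ.≤? b
... | yes a≤b = a≤b
... | no  a≰b = ⊥-elim (ℕ.<⇒≱ (ℕ.+-mono-< (ℕ.≰⇒> a≰b) (ℕ.≰⇒> a≰b)) 2a≤2b)

H-≤-caterpillar : (S C : BTree) → internals S ≡ internals C → IsCaterpillar C → H S ≤ H C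
H-≤-caterpillar S C same c = m+m≤n+n⇒m≤n (ℕ.+-cancelʳ-≤ (i + i) (H S + H S) (H C + H C) (begin
  H S + H S + (i + i)  ≤⟨ subst (λ j → H S + H S + (j + j) ≤ j * suc j) same (H-bound S) ⟩
  i * suc i            ≡⟨ H-bound-caterpillar c ⟨
  H C + H C + (i + i)  ∎))
  where
  open ℕ.≤-Reasoning
  i = internals C

2H-caterpillar : {C : BTree} → IsCaterpillar C → H C + H C ≡ (leafCount C ∸ 1) * (leafCount C ∸ 2)
2H-caterpillar {C} c rewrite leafCount≡1+internals C = ℕ.+-cancelʳ-≡ (i + i) _ _ (trans (H-bound-caterpillar c) (sym (lemma i)))
  where
  open +-*-Solver
  i = internals C
  lemma : ∀ i → i * (i ∸ 1) + (i + i) ≡ i * suc i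
  lemma zero    = refl
  lemma (suc j) = solve 1 (λ j → (con 1 :+ j) :* j :+ ((con 1 :+ j) :+ (con 1 :+ j)) :=
                                 (con 1 :+ j) :* (con 1 :+ (con 1 :+ j))) refl j

ℕtoℚ≡mkℚ : (n : ℕ) → ℕtoℚ n ≡ mkℚ (ℤ.+ n) 0 (Coprime.sym (Coprime.1-coprimeTo n))
ℕtoℚ≡mkℚ n = ℚ.normalize-coprime (Coprime.sym (Coprime.1-coprimeTo n))

ℕtoℚ-+ : (a b : ℕ) → ℕtoℚ (a + b) ≡ ℕtoℚ a +ℚ ℕtoℚ b
ℕtoℚ-+ a b rewrite ℕtoℚ≡mkℚ a | ℕtoℚ≡mkℚ b =
  cong (_/ 1) (sym (cong₂ ℤ._+_ (ℤ.*-identityʳ (ℤ.+ a)) (ℤ.*-identityʳ (ℤ.+ b))))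

ℕtoℚ-nonNeg : (n : ℕ) → 0ℚ ≤ℚ ℕtoℚ n
ℕtoℚ-nonNeg n = ℚ.nonNegative⁻¹ (ℕtoℚ n) {{ℚ.normalize-nonNeg n 1}}

ℕtoℚ-mono-≤ : {a b : ℕ} → a ≤ b → ℕtoℚ a ≤ℚ ℕtoℚ b
ℕtoℚ-mono-≤ {a} {b} a≤b = begin
  ℕtoℚ a                   ≡⟨ ℚ.+-identityʳ (ℕtoℚ a) ⟨
  ℕtoℚ a +ℚ 0ℚ             ≤⟨ ℚ.+-monoʳ-≤ (ℕtoℚ a) (ℕtoℚ-nonNeg (b ∸ a)) ⟩
  ℕtoℚ a +ℚ ℕtoℚ (b ∸ a)   ≡⟨ ℕtoℚ-+ a (b ∸ a) ⟨
  ℕtoℚ (a + (b ∸ a))       ≡⟨ cong ℕtoℚ (ℕ.m+[n∸m]≡n a≤b) ⟩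
  ℕtoℚ b                   ∎
  where open ℚ.≤-Reasoning

weighted : ℚ → ℕ → ℕ → ℚ
weighted α p q = (α *ℚ ℕtoℚ p) +ℚ ((1ℚ -ℚ α) *ℚ ℕtoℚ q)

weighted-+ : (α : ℚ) (a b c d : ℕ) → weighted α a b +ℚ weighted α c d ≡ weighted α (a + c) (b + d)
weighted-+ α a b c d rewrite ℕtoℚ-+ a c | ℕtoℚ-+ b d =
  solve 5 (λ α a b c d → ((α :* a) :+ ((con 1ℚ :- α) :* b)) :+ ((α :* c) :+ ((con 1ℚ :- α) :* d)) :=
                         (α :* (a :+ c)) :+ ((con 1ℚ :- α) :* (b :+ d)))
    refl α (ℕtoℚ a) (ℕtoℚ b) (ℕtoℚ c) (ℕtoℚ d)
  where open ℚSolver.+-*-Solver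

weighted-mono-≤ : {α : ℚ} → 0ℚ ≤ℚ α → α ≤ℚ 1ℚ → {a a′ b b′ : ℕ} → a ≤ a′ → b ≤ b′ →
  weighted α a b ≤ℚ weighted α a′ b′
weighted-mono-≤ {α} 0≤α α≤1 a≤a′ b≤b′ =
  ℚ.+-mono-≤ (ℚ.*-monoˡ-≤-nonNeg α {{nonNegative 0≤α}} (ℕtoℚ-mono-≤ a≤a′))
             (ℚ.*-monoˡ-≤-nonNeg (1ℚ -ℚ α) {{nonNegative 0≤1-α}} (ℕtoℚ-mono-≤ b≤b′))
  where
  0≤1-α : 0ℚ ≤ℚ 1ℚ -ℚ α
  0≤1-α = subst (_≤ℚ 1ℚ -ℚ α) (ℚ.+-inverseʳ α) (ℚ.+-monoˡ-≤ (- α) α≤1)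

2α-weighted : (α : ℚ) (h k : ℕ) →
  (ℕtoℚ 2 *ℚ α *ℚ ℕtoℚ h) +ℚ ((1ℚ -ℚ α) *ℚ ℕtoℚ k) ≡ weighted α (h + h) k
2α-weighted α h k rewrite ℕtoℚ-+ h h | ℕtoℚ-+ 1 1 =
  solve 3 (λ α h k → (((con 1ℚ :+ con 1ℚ) :* α) :* h) :+ ((con 1ℚ :- α) :* k) :=
                     (α :* (h :+ h)) :+ ((con 1ℚ :- α) :* k))
    refl α (ℕtoℚ h) (ℕtoℚ k)
  where open ℚSolver.+-*-Solver

internals-cong : {S C : BTree} → leafCount S ≡ leafCount C → internals S ≡ internals C
internals-cong {S} {C} e = ℕ.suc-injective (trans (sym (leafCount≡1+internals S)) (trans e (leafCount≡1+internals C)))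

2n∸2≡internals+internals : (t : BTree) → 2 * leafCount t ∸ 2 ≡ internals t + internals t
2n∸2≡internals+internals t
  rewrite leafCount≡1+internals t | ℕ.+-identityʳ (internals t) | ℕ.+-suc (internals t) (internals t) = refl


dPLR-witness : (α : ℚ) (S : BTree) →
  dPLR α (Witness.G₁ S) (Witness.G₂ S) ≡ weighted α (H S + H S) (internals S + internals S)
dPLR-witness α S =
  trans (weighted-+ α (dpath G₁ G₂) (dlbl G₁ G₂) (dpath G₂ G₁) (dlbl G₂ G₁))
        (cong₂ (weighted α) (cong₂ _+_ dpath-G₁G₂ dpath-G₂G₁) (cong₂ _+_ dlbl-G₁G₂ dlbl-G₂G₁))
  where open Witness S

module _ {α : ℚ} (0≤α : 0ℚ ≤ℚ α) (α≤1 : α ≤ℚ 1ℚ) where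

  dPLR-≤ : {G₁ G₂ : RG S} → InGS S G₁ → InGS S G₂ →
    dPLR α G₁ G₂ ≤ℚ weighted α (H S + H S) (internals S + internals S)
  dPLR-≤ {S} {G₁} {G₂} G₁∈ G₂∈ = begin
    dPLR α G₁ G₂
      ≡⟨ weighted-+ α (dpath G₁ G₂) (dlbl G₁ G₂) (dpath G₂ G₁) (dlbl G₂ G₁) ⟩
    weighted α (dpath G₁ G₂ + dpath G₂ G₁) (dlbl G₁ G₂ + dlbl G₂ G₁)
      ≤⟨ weighted-mono-≤ 0≤α α≤1 (ℕ.+-mono-≤ (dpath-≤-H G₁∈ G₂∈) (dpath-≤-H G₂∈ G₁∈))
                                  (ℕ.+-mono-≤ (dlbl-≤-internals G₁∈ G₂∈) (dlbl-≤-internals G₂∈ G₁∈)) ⟩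
    weighted α (H S + H S) (internals S + internals S)               ∎
    where open ℚ.≤-Reasoning

  IsDiam-weighted : (S : BTree) → IsDiam S α (weighted α (H S + H S) (internals S + internals S))
  IsDiam-weighted S = (λ _ _ → dPLR-≤) , G₁ , G₂ , InGS-G₁ , InGS-G₂ , dPLR-witness α S
    where open Witness S

  IsDiam-≤-weighted : {D : ℚ} → IsDiam S α D → D ≤ℚ weighted α (H S + H S) (internals S + internals S)
  IsDiam-≤-weighted (_ , G₁ , G₂ , G₁∈ , G₂∈ , D≡) = subst (_≤ℚ _) D≡ (dPLR-≤ {G₁ = G₁} {G₂} G₁∈ G₂∈)

  weighted-≤-IsDiam : {D : ℚ} → IsDiam S α D → weighted α (H S + H S) (internals S + internals S) ≤ℚ D
  weighted-≤-IsDiam {S} (bound , _) = subst (_≤ℚ _) (dPLR-witness α S) (bound G₁ G₂ InGS-G₁ InGS-G₂)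
    where open Witness S

  IsDiam-2αH : (S : BTree) →
    IsDiam S α ((ℕtoℚ 2 *ℚ α *ℚ ℕtoℚ (H S)) +ℚ ((1ℚ -ℚ α) *ℚ ℕtoℚ (2 * leafCount S ∸ 2)))
  IsDiam-2αH S rewrite 2n∸2≡internals+internals S | 2α-weighted α (H S) (internals S + internals S) = IsDiam-weighted S

  IsDiam-≤-caterpillar : {C : BTree} {D D′ : ℚ} → leafCount S ≡ leafCount C → IsCaterpillar C →
    IsDiam S α D → IsDiam C α D′ → D ≤ℚ D′
  IsDiam-≤-caterpillar {S} {C} {D} {D′} same-n c D-S D′-C = begin
    D                                                   ≤⟨ IsDiam-≤-weighted D-S ⟩
    weighted α (H S + H S) (internals S + internals S)
      ≤⟨ weighted-mono-≤ 0≤α α≤1 (ℕ.+-mono-≤ H≤ H≤) (ℕ.≤-reflexive (cong₂ _+_ same same)) ⟩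
    weighted α (H C + H C) (internals C + internals C)  ≤⟨ weighted-≤-IsDiam D′-C ⟩
    D′                                                  ∎
    where
    open ℚ.≤-Reasoning
    same = internals-cong same-n
    H≤ = H-≤-caterpillar S C same c

  IsDiam-caterpillar : {C : BTree} → IsCaterpillar C →
    IsDiam C α ((α *ℚ ℕtoℚ ((leafCount C ∸ 1) * (leafCount C ∸ 2))) +ℚ ((1ℚ -ℚ α) *ℚ ℕtoℚ (2 * leafCount C ∸ 2)))
  IsDiam-caterpillar {C} c rewrite 2n∸2≡internals+internals C =
    subst (λ h → IsDiam C α (weighted α h (internals C + internals C))) (2H-caterpillar c) (IsDiam-weighted C)

theorem3 : (α : ℚ) → 0ℚ ≤ℚ α → α ≤ℚ 1ℚ → (n : ℕ) → 2 ≤ n →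
    ((S : BTree) → leafCount S ≡ n →
    IsDiam S α ((ℕtoℚ 2 *ℚ α *ℚ ℕtoℚ (H S)) +ℚ ((1ℚ -ℚ α) *ℚ ℕtoℚ (2 * n ∸ 2)))) ×
    ((S C : BTree) → leafCount S ≡ n → leafCount C ≡ n → IsCaterpillar C →
    ((D D′ : ℚ) → IsDiam S α D → IsDiam C α D′ → D ≤ℚ D′) ×
    IsDiam C α ((α *ℚ ℕtoℚ ((n ∸ 1) * (n ∸ 2))) +ℚ ((1ℚ -ℚ α) *ℚ ℕtoℚ (2 * n ∸ 2))))
theorem3 α 0≤α α≤1 n _ =
  (λ { S refl → IsDiam-2αH 0≤α α≤1 S }) ,
  (λ { S C S-n refl c → (λ _ _ → IsDiam-≤-caterpillar 0≤α α≤1 S-n c) , IsDiam-caterpillar 0≤α α≤1 c })
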